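{- Let $h\geq 3$ and $k\geq 3h+3$ be positive integers, and let $A=[0,k+1]\setminus\{2,y\}$ with $y\in[5,k]$. (i) If $y\in[k-(h-2),k]$, then $|h^{\wedge}A| = hk-h^2+k-y+4$. (ii) If $y\in\{h+1,k-(h-1)\}$, then $|h^{\wedge}A| = hk-h^2+h+2$. (iii) If $y\in[h+3,k-h]$, then $|h^{\wedge}A| = hk-h^2+h+3$. (iv) If $y=h+2$, then $|h^{\wedge}A| = hk-h^2+h+3$ when $h\geq 4$, and $|h^{\wedge}A| = 3k-4$ when $h=3$. (v) If $y\in[5,h]$, then $|h^{\wedge}A| = hk-h^2+y+2$.
   Context: For a finite set $A$ of integers and a positive integer $h\le |A|$, the restricted $h$-fold sumset $h^{\wedge}A$ is the set of all sums of $h$ distinct elements of $A$. For integers $\alpha\le\beta$, $[\alpha,\beta]=\{x\in\mathbb{Z}:\alpha\le x\le\beta\}$ (empty if $\alpha>\beta$). -}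

module Defs where

open import Data.Nat using (ℕ)
open import Data.Integer using (ℤ; +_; _+_; _≤_)
open import Data.List using (List; length; foldr)
open import Data.List.Relation.Unary.All using (All)
open import Data.List.Relation.Unary.Unique.Propositional using (Unique)
open import Data.List.Membership.Propositional using (_∈_)
open import Data.Product using (Σ; _×_)
open import Function.Bundles using (_⇔_)
open import Relation.Binary.PropositionalEquality using (_≡_; _≢_)

sumℤ : List ℤ → ℤ
sumℤ = foldr _+_ (+ 0)

RestrictedSumset : ℕ → (ℤ → Set) → ℤ → Set
RestrictedSumset h A x =
  Σ (List ℤ) λ B → Unique B × All A B × length B ≡ h × sumℤ B ≡ x

HasCard : (ℤ → Set) → ℕ → Set
HasCard S n =
  Σ (List ℤ) λ xs → Unique xs × (∀ x → (x ∈ xs) ⇔ S x) × length xs ≡ n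

SetA : ℕ → ℕ → ℤ → Set
SetA k y x = (+ 0 ≤ x) × (x ≤ + (Data.Nat._+_ k 1)) × (x ≢ + 2) × (x ≢ + y)

-- |S| = m for an integer m (the cardinality formulas are integer expressions).
CardIs : (ℤ → Set) → ℤ → Set
CardIs S m = Σ ℕ λ n → HasCard S n × (+ n ≡ m)

-- Write y = p + 1. The set A = [0, k + 1] ∖ {2, y} has exactly k elements, enumerated increasingly by
-- enum p c = c + [2 ≤ c] + [p ≤ c] for c < k, so h^A consists of the sums σ C of enum over h-subsets C
-- of [0, k). These sums lie between L, the sum over [0, h), and U, the sum over [k - h, k). For
-- j = 0, …, h - 1 take the initial block [0, h - 1 - j), the final block of the j largest indices and one
-- free index t between them: as t moves, the sum runs through the values of enum on an interval, and these
-- h intervals tile [L, U]. The sum misses a value only where enum t would have to be 2 or y; all these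
-- values are reached by trading two indices instead, except exactly three: L + 1 when y = h + 1,
-- U - 1 when y = k - h + 1, and L + 2 when h = 3 and y = 5. So |h^A| = U - L + 1 minus the number of
-- these gaps, and U - L = h (k - h) + 2 + (h ∸ (p ∸ (k - h))) - (h ∸ p) gives the five formulas.

module Submission where

open import Defs
open import Data.Integer as ℤ using (ℤ) renaming (_+_ to _+ℤ_; _-_ to _-ℤ_; _*_ to _*ℤ_)
import Data.Integer.Properties as ℤₚ
open import Data.Nat
open import Data.Nat.ListAction using (sum)
open import Data.Nat.ListAction.Properties using (sum-++)
open import Data.Nat.Properties
open import Algebra.Properties.CommutativeSemigroup +-commutativeSemigroup using (x∙yz≈y∙xz; interchange)
open import Data.Nat.Tactic.RingSolver using (solve-∀)
import Data.Integer.Tactic.RingSolver as ℤ-Solver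
open import Data.List using (List; []; _∷_; _++_; length; map; iterate)
open import Data.List.Properties using (length-++; length-iterate; length-map; map-++; map-id)
open import Data.List.Membership.Propositional using (_∈_; find)
open import Data.List.Membership.Propositional.Properties using (∈-map⁺; ∈-map⁻; ∈-++⁺ˡ; ∈-++⁺ʳ; ∈-++⁻)
open import Data.List.Relation.Unary.All as All using (All; []; _∷_)
import Data.List.Relation.Unary.All.Properties as All
open import Data.List.Relation.Unary.AllPairs using ([]; _∷_)
open import Data.List.Relation.Unary.Any using (here; there; any?)
open import Data.List.Relation.Unary.Unique.Propositional using (Unique)
import Data.List.Relation.Unary.Unique.Propositional.Properties as Unique
open import Data.Product using (Σ; _×_; _,_; proj₁; proj₂)
open import Data.Sum using (_⊎_; inj₁; inj₂)
open import Function using (_∘_)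
open import Function.Bundles using (_⇔_; mk⇔; Equivalence)
open import Relation.Binary.Definitions using (tri<; tri≈; tri>)
open import Relation.Unary using (Decidable)
open import Relation.Binary.PropositionalEquality
open import Relation.Nullary using (¬_; yes; no; contradiction; ¬?)
open import Relation.Nullary.Decidable using (from-yes; _→-dec_)

data Ascending : ℕ → List ℕ → ℕ → Set where
  nil  : ∀ {lo hi} → lo ≤ hi → Ascending lo [] hi
  cons : ∀ {lo x xs hi} → lo ≤ x → Ascending (suc x) xs hi → Ascending lo (x ∷ xs) hi

Ascending-weaken : ∀ {lo mid xs hi} → lo ≤ mid → Ascending mid xs hi → Ascending lo xs hi
Ascending-weaken lo≤mid (nil mid≤hi)   = nil (≤-trans lo≤mid mid≤hi)
Ascending-weaken lo≤mid (cons mid≤x a) = cons (≤-trans lo≤mid mid≤x) a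

Ascending-++ : ∀ {lo mid hi xs ys} → Ascending lo xs mid → Ascending mid ys hi → Ascending lo (xs ++ ys) hi
Ascending-++ (nil lo≤mid) b = Ascending-weaken lo≤mid b
Ascending-++ (cons lo≤x a) b = cons lo≤x (Ascending-++ a b)

Ascending⇒≤ : ∀ {lo xs hi} → Ascending lo xs hi → lo ≤ hi
Ascending⇒≤ (nil lo≤hi)   = lo≤hi
Ascending⇒≤ (cons lo≤x a) = ≤-trans lo≤x (<⇒≤ (Ascending⇒≤ a))

Ascending⇒bounded : ∀ {lo xs hi} → Ascending lo xs hi → All (λ z → lo ≤ z × z < hi) xs
Ascending⇒bounded (nil _) = []
Ascending⇒bounded (cons lo≤x a) =
  (lo≤x , Ascending⇒≤ a) ∷ All.map (λ (x<z , z<hi) → ≤-trans lo≤x (<⇒≤ x<z) , z<hi) (Ascending⇒bounded a)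

Ascending⇒Unique : ∀ {lo xs hi} → Ascending lo xs hi → Unique xs
Ascending⇒Unique (nil _) = []
Ascending⇒Unique (cons _ a) = All.map (λ (x<z , _) x≡z → <⇒≢ x<z x≡z) (Ascending⇒bounded a) ∷ Ascending⇒Unique a

Ascending-iterate : ∀ o n → Ascending o (iterate suc o n) (o + n)
Ascending-iterate o zero    = nil (m≤m+n o 0)
Ascending-iterate o (suc n) = cons ≤-refl (subst (Ascending (suc o) _) (sym (+-suc o n)) (Ascending-iterate (suc o) n))

∈-iterate⁻ : ∀ {m} o n → m ∈ iterate suc o n → o ≤ m × m < o + n
∈-iterate⁻ o n = All.lookup (Ascending⇒bounded (Ascending-iterate o n))

∈-iterate⁺ : ∀ {m} o n → o ≤ m → m < o + n → m ∈ iterate suc o n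
∈-iterate⁺ o zero o≤m m<o+0 = contradiction (≤-trans m<o+0 (≤-reflexive (+-identityʳ o))) (≤⇒≯ o≤m)
∈-iterate⁺ {m} o (suc n) o≤m m<o+n with m ≟ o
... | yes refl = here refl
... | no m≢o   = there (∈-iterate⁺ (suc o) n (≤∧≢⇒< o≤m (m≢o ∘ sym)) (≤-trans m<o+n (≤-reflexive (+-suc o n))))

sum-map-++ : ∀ (f : ℕ → ℕ) xs ys → sum (map f (xs ++ ys)) ≡ sum (map f xs) + sum (map f ys)
sum-map-++ f xs ys = trans (cong sum (map-++ f xs ys)) (sum-++ (map f xs) (map f ys))

record Removal (f : ℕ → ℕ) (x : ℕ) (C : List ℕ) : Set where
  field
    rest        : List ℕ
    rest-unique : Unique rest
    length-rest : length C ≡ suc (length rest)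
    sum-rest    : sum (map f C) ≡ f x + sum (map f rest)
    rest-⊆      : ∀ {z} → z ∈ rest → z ∈ C × z ≢ x

  restrict : ∀ {P : ℕ → Set} → All P C → All (λ z → P z × z ≢ x) rest
  restrict all = All.tabulate (λ z∈rest → let (z∈C , z≢x) = rest-⊆ z∈rest in All.lookup all z∈C , z≢x)

pick : ∀ (f : ℕ → ℕ) {x C} → x ∈ C → Unique C → Removal f x C
pick f (here refl) (x∉C ∷ C!) = record
  { rest = _ ; rest-unique = C! ; length-rest = refl ; sum-rest = refl
  ; rest-⊆ = λ z∈C → there z∈C , λ z≡x → All.lookup x∉C z∈C (sym z≡x) }
pick f {x} {c ∷ C} (there x∈C) (c∉C ∷ C!) = record
  { rest = c ∷ rest
  ; rest-unique = All.tabulate (λ z∈rest → All.lookup c∉C (proj₁ (rest-⊆ z∈rest))) ∷ rest-unique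
  ; length-rest = cong suc length-rest
  ; sum-rest = trans (cong (f c +_) sum-rest) (x∙yz≈y∙xz (f c) (f x) _)
  ; rest-⊆ = λ { (here refl) → here refl , λ c≡x → All.lookup c∉C x∈C c≡x
               ; (there z∈rest) → there (proj₁ (rest-⊆ z∈rest)) , proj₂ (rest-⊆ z∈rest) } }
  where open Removal (pick f x∈C C!)

pick-if : ∀ (f : ℕ → ℕ) {Q : ℕ → Set} → Decidable Q → ∀ C → Unique C → All (¬_ ∘ Q) C ⊎ Σ ℕ λ c → Q c × Removal f c C
pick-if f Q? C C! with any? Q? C
... | no none = inj₁ (All.¬Any⇒All¬ C none)
... | yes some = let (c , c∈C , Qc) = find some in inj₂ (c , Qc , pick f c∈C C!)

sum-map-+ : ∀ (f g : ℕ → ℕ) xs → sum (map (λ x → f x + g x) xs) ≡ sum (map f xs) + sum (map g xs)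
sum-map-+ f g [] = refl
sum-map-+ f g (x ∷ xs) = trans (cong (f x + g x +_) (sum-map-+ f g xs)) (interchange (f x) (g x) _ _)

sum-iterate : ∀ o n → sum (iterate suc o n) ≡ n * o + sum (iterate suc 0 n)
sum-iterate o zero = refl
sum-iterate o (suc n) rewrite sum-iterate (suc o) n | sum-iterate 1 n = lemma o n (sum (iterate suc 0 n))
  where
  lemma : ∀ o n t → o + (n * suc o + t) ≡ o + n * o + (n * 1 + t)
  lemma = solve-∀

-- Sums of a monotone function over blocks of consecutive integers

module MonotoneSums (f : ℕ → ℕ) (f-mono : ∀ {a b} → a ≤ b → f a ≤ f b) where

  blockSum : ℕ → ℕ → ℕ
  blockSum o n = sum (map f (iterate suc o n))

  blockSum-snoc : ∀ o n → blockSum o (suc n) ≡ blockSum o n + f (o + n)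
  blockSum-snoc o zero    = trans (+-comm (f o) 0) (cong f (sym (+-identityʳ o)))
  blockSum-snoc o (suc n) = begin
    f o + blockSum (suc o) (suc n)        ≡⟨ cong (f o +_) (blockSum-snoc (suc o) n) ⟩
    f o + (blockSum (suc o) n + f (suc o + n)) ≡⟨ sym (+-assoc (f o) _ _) ⟩
    blockSum o (suc n) + f (suc o + n)    ≡⟨ cong (λ z → blockSum o (suc n) + f z) (sym (+-suc o n)) ⟩
    blockSum o (suc n) + f (o + suc n)    ∎
    where open ≡-Reasoning

  blockSum-mono : ∀ {o o′} n → o ≤ o′ → blockSum o n ≤ blockSum o′ n
  blockSum-mono zero    _    = ≤-refl
  blockSum-mono (suc n) o≤o′ = +-mono-≤ (f-mono o≤o′) (blockSum-mono n (s≤s o≤o′))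

  private
    below-top : ∀ {o N z} → z < o + suc N → z ≢ o + N → z < o + N
    below-top {o} {N} z<o+1+N z≢o+N = ≤∧≢⇒< (≤-pred (≤-trans z<o+1+N (≤-reflexive (+-suc o N)))) z≢o+N

  -- Simultaneous induction: the length bound is needed to compare the top elements.
  length≤∧blockSum≤sum : ∀ N o C → Unique C → All (λ c → o ≤ c × c < o + N) C →
                         length C ≤ N × blockSum o (length C) ≤ sum (map f C)
  length≤∧blockSum≤sum zero o [] _ _ = z≤n , z≤n
  length≤∧blockSum≤sum zero o (c ∷ C) _ ((o≤c , c<o+0) ∷ _) =
    contradiction (≤-trans c<o+0 (≤-reflexive (+-identityʳ o))) (≤⇒≯ o≤c)
  length≤∧blockSum≤sum (suc N) o C C! bounds with any? (o + N ≟_) C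
  ... | yes top∈C = ≤-trans (≤-reflexive length-rest) (s≤s len≤) , sum≥
    where
    open Removal (pick f top∈C C!)
    ih = length≤∧blockSum≤sum N o rest rest-unique
           (All.map (λ ((o≤z , z<) , z≢top) → o≤z , below-top z< z≢top) (restrict bounds))
    len≤ = proj₁ ih
    sum≥ : blockSum o (length C) ≤ sum (map f C)
    sum≥ = begin
      blockSum o (length C)                       ≡⟨ cong (blockSum o) length-rest ⟩
      blockSum o (suc (length rest))              ≡⟨ blockSum-snoc o (length rest) ⟩
      blockSum o (length rest) + f (o + length rest) ≤⟨ +-mono-≤ (proj₂ ih) (f-mono (+-monoʳ-≤ o len≤)) ⟩
      sum (map f rest) + f (o + N)                ≡⟨ +-comm (sum (map f rest)) _ ⟩
      f (o + N) + sum (map f rest)                ≡⟨ sym sum-rest ⟩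
      sum (map f C)                               ∎
      where open ≤-Reasoning
  ... | no top∉C = m≤n⇒m≤1+n (proj₁ ih) , proj₂ ih
    where
    ih = length≤∧blockSum≤sum N o C C!
           (All.tabulate (λ {z} z∈C → let (o≤z , z<) = All.lookup bounds z∈C in
                                       o≤z , below-top z< (λ z≡top → top∉C (subst (_∈ C) z≡top z∈C))))

  length≤ : ∀ N C → Unique C → All (_< N) C → length C ≤ N
  length≤ N C C! bounds = proj₁ (length≤∧blockSum≤sum N 0 C C! (All.map (z≤n ,_) bounds))

  initialBlock≤sum : ∀ N C → Unique C → All (_< N) C → blockSum 0 (length C) ≤ sum (map f C)
  initialBlock≤sum N C C! bounds = proj₂ (length≤∧blockSum≤sum N 0 C C! (All.map (z≤n ,_) bounds))

  sum≤finalBlock : ∀ N C → Unique C → All (_< N) C → sum (map f C) ≤ blockSum (N ∸ length C) (length C)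
  sum≤finalBlock zero [] _ _ = z≤n
  sum≤finalBlock zero (_ ∷ _) _ (() ∷ _)
  sum≤finalBlock (suc N) C C! bounds with any? (N ≟_) C
  ... | yes top∈C = subst (λ l → sum (map f C) ≤ blockSum (suc N ∸ l) l) (sym length-rest) sum≤
    where
    open Removal (pick f top∈C C!)
    rest<N : All (_< N) rest
    rest<N = All.map (λ (z<1+N , z≢N) → ≤∧≢⇒< (≤-pred z<1+N) z≢N) (restrict bounds)
    l = length rest
    l≤N : l ≤ N
    l≤N = length≤ N rest rest-unique rest<N
    sum≤ : sum (map f C) ≤ blockSum (N ∸ l) (suc l)
    sum≤ = begin
      sum (map f C)                        ≡⟨ sum-rest ⟩
      f N + sum (map f rest)               ≤⟨ +-monoʳ-≤ (f N) (sum≤finalBlock N rest rest-unique rest<N) ⟩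
      f N + blockSum (N ∸ l) l             ≡⟨ +-comm (f N) _ ⟩
      blockSum (N ∸ l) l + f N             ≡⟨ cong (λ z → blockSum (N ∸ l) l + f z) (sym (m∸n+n≡m l≤N)) ⟩
      blockSum (N ∸ l) l + f (N ∸ l + l)   ≡⟨ sym (blockSum-snoc (N ∸ l) l) ⟩
      blockSum (N ∸ l) (suc l)             ∎
      where open ≤-Reasoning
  ... | no top∉C = ≤-trans (sum≤finalBlock N C C! C<N) (blockSum-mono (length C) (∸-monoˡ-≤ (length C) (n≤1+n N)))
    where
    C<N : All (_< N) C
    C<N = All.tabulate (λ {z} z∈C → ≤∧≢⇒< (≤-pred (All.lookup bounds z∈C)) (λ z≡N → top∉C (subst (_∈ C) z≡N z∈C)))

-- The enumeration of A

⟦_≤_⟧ : ℕ → ℕ → ℕ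
⟦ q ≤ c ⟧ = 1 ∸ (q ∸ c)

⟦≤⟧-yes : ∀ {q c} → q ≤ c → ⟦ q ≤ c ⟧ ≡ 1
⟦≤⟧-yes q≤c = cong (1 ∸_) (m≤n⇒m∸n≡0 q≤c)

⟦≤⟧-no : ∀ {q c} → c < q → ⟦ q ≤ c ⟧ ≡ 0
⟦≤⟧-no {q} {c} c<q = m≤n⇒m∸n≡0 (m<n⇒0<n∸m c<q)

⟦≤⟧-mono : ∀ q {a b} → a ≤ b → ⟦ q ≤ a ⟧ ≤ ⟦ q ≤ b ⟧
⟦≤⟧-mono q a≤b = ∸-monoʳ-≤ 1 (∸-monoʳ-≤ q a≤b)

⟦≤⟧-suc : ∀ {q c} → suc c ≢ q → ⟦ q ≤ suc c ⟧ ≡ ⟦ q ≤ c ⟧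
⟦≤⟧-suc {q} {c} 1+c≢q with <-cmp q (suc c)
... | tri< q<1+c _ _ = trans (⟦≤⟧-yes (<⇒≤ q<1+c)) (sym (⟦≤⟧-yes (≤-pred q<1+c)))
... | tri≈ _ q≡1+c _ = contradiction (sym q≡1+c) 1+c≢q
... | tri> _ _ 1+c<q = trans (⟦≤⟧-no 1+c<q) (sym (⟦≤⟧-no (<-trans (n<1+n c) 1+c<q)))

∸-≡suc∸suc : ∀ {q o} → o < q → q ∸ o ≡ suc (q ∸ suc o)
∸-≡suc∸suc {q} {o} o<q =
  trans (sym (suc-pred (q ∸ o) {{>-nonZero (m<n⇒0<n∸m o<q)}})) (cong suc (pred[m∸n]≡m∸[1+n] q o))

sum-⟦≤⟧ : ∀ q o n → sum (map ⟦ q ≤_⟧ (iterate suc o n)) ≡ n ∸ (q ∸ o)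
sum-⟦≤⟧ q o zero = sym (0∸n≡0 (q ∸ o))
sum-⟦≤⟧ q o (suc n) with q ≤? o
... | yes q≤o rewrite ⟦≤⟧-yes q≤o | sum-⟦≤⟧ q (suc o) n | m≤n⇒m∸n≡0 q≤o | m≤n⇒m∸n≡0 (m≤n⇒m≤1+n q≤o) = refl
... | no q≰o rewrite ⟦≤⟧-no (≰⇒> q≰o) | sum-⟦≤⟧ q (suc o) n | ∸-≡suc∸suc (≰⇒> q≰o) = refl

-- enum p c is the c-th element (counting from 0) of ℕ ∖ {2, p + 1}.
enum : ℕ → ℕ → ℕ
enum p c = c + ⟦ 2 ≤ c ⟧ + ⟦ p ≤ c ⟧

module Enumeration (p : ℕ) (4≤p : 4 ≤ p) where

  enum-mono : ∀ {a b} → a ≤ b → enum p a ≤ enum p b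
  enum-mono a≤b = +-mono-≤ (+-mono-≤ a≤b (⟦≤⟧-mono 2 a≤b)) (⟦≤⟧-mono p a≤b)

  enum-strict : ∀ {a b} → a < b → enum p a < enum p b
  enum-strict a<b = +-mono-<-≤ (+-mono-<-≤ a<b (⟦≤⟧-mono 2 (<⇒≤ a<b))) (⟦≤⟧-mono p (<⇒≤ a<b))

  enum-cancel-≤ : ∀ {a b} → enum p a ≤ enum p b → a ≤ b
  enum-cancel-≤ {a} {b} ea≤eb with a ≤? b
  ... | yes a≤b = a≤b
  ... | no a≰b  = contradiction ea≤eb (<⇒≱ (enum-strict (≰⇒> a≰b)))

  enum-injective : ∀ {a b} → enum p a ≡ enum p b → a ≡ b
  enum-injective ea≡eb = ≤-antisym (enum-cancel-≤ (≤-reflexive ea≡eb)) (enum-cancel-≤ (≤-reflexive (sym ea≡eb)))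

  open MonotoneSums (enum p) enum-mono public

  2<p : 2 < p
  2<p = ≤-trans (s≤s (s≤s (s≤s z≤n))) 4≤p

  enum-low : ∀ {c} → c < 2 → enum p c ≡ c
  enum-low {c} c<2 rewrite ⟦≤⟧-no c<2 | ⟦≤⟧-no (<-trans c<2 2<p) = trans (+-identityʳ _) (+-identityʳ c)

  enum-mid : ∀ {c} → 2 ≤ c → c < p → enum p c ≡ suc c
  enum-mid {c} 2≤c c<p rewrite ⟦≤⟧-yes 2≤c | ⟦≤⟧-no c<p = trans (+-identityʳ _) (+-comm c 1)

  enum-high : ∀ {c} → p ≤ c → enum p c ≡ 2 + c
  enum-high {c} p≤c rewrite ⟦≤⟧-yes (≤-trans (<⇒≤ 2<p) p≤c) | ⟦≤⟧-yes p≤c = trans (+-assoc c 1 1) (+-comm c 2)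

  enum-≤ : ∀ c → enum p c ≤ 2 + c
  enum-≤ c = ≤-trans (+-mono-≤ (+-monoʳ-≤ c (m∸n≤m 1 (2 ∸ c))) (m∸n≤m 1 (p ∸ c))) (≤-reflexive (trans (+-assoc c 1 1) (+-comm c 2)))

  enum-suc : ∀ {c} → suc c ≢ 2 → suc c ≢ p → enum p (suc c) ≡ suc (enum p c)
  enum-suc {c} 1+c≢2 1+c≢p rewrite ⟦≤⟧-suc 1+c≢2 | ⟦≤⟧-suc 1+c≢p = refl

  private
    data Region (c : ℕ) : Set where
      low  : c < 2 → Region c
      mid  : 2 ≤ c → c < p → Region c
      high : p ≤ c → Region c

    region : ∀ c → Region c
    region c with c <? 2 | c <? p
    ... | yes c<2 | _       = low c<2
    ... | no c≮2  | yes c<p = mid (≮⇒≥ c≮2) c<p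
    ... | no _    | no c≮p  = high (≮⇒≥ c≮p)

  enum≢2 : ∀ c → enum p c ≢ 2
  enum≢2 c ec≡2 with region c
  ... | low c<2       = <⇒≢ (subst (_< 2) (sym (enum-low c<2)) c<2) ec≡2
  ... | mid 2≤c c<p   = >⇒≢ (subst (2 <_) (sym (enum-mid 2≤c c<p)) (s≤s 2≤c)) ec≡2
  ... | high p≤c      = >⇒≢ (subst (2 <_) (sym (enum-high p≤c)) (≤-trans 2<p (≤-trans p≤c (m≤n+m c 2)))) ec≡2

  enum≢1+p : ∀ c → enum p c ≢ suc p
  enum≢1+p c ec≡1+p with region c
  ... | low c<2       = <⇒≢ (subst (_< suc p) (sym (enum-low c<2)) (≤-trans c<2 (<⇒≤ (m<n⇒m<1+n 2<p)))) ec≡1+p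
  ... | mid 2≤c c<p   = <⇒≢ (subst (_< suc p) (sym (enum-mid 2≤c c<p)) (s≤s c<p)) ec≡1+p
  ... | high p≤c      = >⇒≢ (subst (suc p <_) (sym (enum-high p≤c)) (s≤s (s≤s p≤c))) ec≡1+p

  enum-surjective : ∀ b → b ≢ 2 → b ≢ suc p → Σ ℕ λ c → enum p c ≡ b
  enum-surjective 0 _ _ = 0 , enum-low (s≤s z≤n)
  enum-surjective 1 _ _ = 1 , enum-low (s≤s (s≤s z≤n))
  enum-surjective 2 b≢2 _ = contradiction refl b≢2
  enum-surjective (suc (suc (suc b))) _ b≢1+p with suc (suc b) <? p
  ... | yes 2+b<p = suc (suc b) , enum-mid (s≤s (s≤s z≤n)) 2+b<p
  ... | no 2+b≮p  = suc b , enum-high (≤-pred (≤∧≢⇒< (≮⇒≥ 2+b≮p) (λ p≡2+b → b≢1+p (cong suc (sym p≡2+b)))))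

  blockSum-0-2 : blockSum 0 2 ≡ 1
  blockSum-0-2 = cong₂ _+_ (enum-low (s≤s z≤n)) (cong (_+ 0) (enum-low (s≤s (s≤s z≤n))))

  blockSum-0-3 : blockSum 0 3 ≡ 4
  blockSum-0-3 = cong₂ _+_ (enum-low (s≤s z≤n)) (cong₂ _+_ (enum-low (s≤s (s≤s z≤n))) (cong (_+ 0) (enum-mid ≤-refl 2<p)))

  enum-<p : ∀ {c} → c < p → enum p c ≤ suc c
  enum-<p {c} c<p with region c
  ... | low c<2     = ≤-trans (≤-reflexive (enum-low c<2)) (n≤1+n c)
  ... | mid 2≤c _   = ≤-reflexive (enum-mid 2≤c c<p)
  ... | high p≤c    = contradiction p≤c (<⇒≱ c<p)

  blockSum-closed : ∀ o n → blockSum o n ≡ n * o + sum (iterate suc 0 n) + (n ∸ (2 ∸ o)) + (n ∸ (p ∸ o))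
  blockSum-closed o n = begin
    sum (map (enum p) xs)                                                ≡⟨ sum-map-+ (λ c → c + ⟦ 2 ≤ c ⟧) ⟦ p ≤_⟧ xs ⟩
    sum (map (λ c → c + ⟦ 2 ≤ c ⟧) xs) + sum (map ⟦ p ≤_⟧ xs)            ≡⟨ cong₂ _+_ (sum-map-+ (λ c → c) ⟦ 2 ≤_⟧ xs) (sum-⟦≤⟧ p o n) ⟩
    sum (map (λ c → c) xs) + sum (map ⟦ 2 ≤_⟧ xs) + (n ∸ (p ∸ o))        ≡⟨ cong₂ (λ s t → s + t + (n ∸ (p ∸ o))) sum-xs (sum-⟦≤⟧ 2 o n) ⟩
    n * o + sum (iterate suc 0 n) + (n ∸ (2 ∸ o)) + (n ∸ (p ∸ o))        ∎
    where
    open ≡-Reasoning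
    xs = iterate suc o n
    sum-xs : sum (map (λ c → c) xs) ≡ n * o + sum (iterate suc 0 n)
    sum-xs = trans (cong sum (map-id xs)) (sum-iterate o n)

-- On [0, 4), enum 4 takes the values 0, 1, 3, 4.
sum-enum4≢6 : ∀ C → Unique C → All (_< 4) C → length C ≡ 3 → sum (map (enum 4) C) ≢ 6
sum-enum4≢6 (a ∷ b ∷ c ∷ []) ((a≢b ∷ a≢c ∷ []) ∷ (b≢c ∷ []) ∷ [] ∷ []) (a<4 ∷ b<4 ∷ c<4 ∷ []) refl =
  by-computation a<4 b<4 c<4 a≢b a≢c b≢c
  where
  by-computation : ∀ {a} → a < 4 → ∀ {b} → b < 4 → ∀ {c} → c < 4 →
                   a ≢ b → a ≢ c → b ≢ c → enum 4 a + (enum 4 b + (enum 4 c + 0)) ≢ 6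
  by-computation = from-yes
    (allUpTo? (λ a → allUpTo? (λ b → allUpTo? (λ c →
       ¬? (a ≟ b) →-dec ¬? (a ≟ c) →-dec ¬? (b ≟ c) →-dec ¬? (enum 4 a + (enum 4 b + (enum 4 c + 0)) ≟ 6)) 4) 4) 4)

ℕ-image : (ℕ → Set) → ℤ → Set
ℕ-image P x = Σ ℕ λ m → x ≡ ℤ.+ m × P m

HasCard-ℕ-image : ∀ {P : ℕ → Set} ys → Unique ys → (∀ m → m ∈ ys ⇔ P m) → HasCard (ℕ-image P) (length ys)
HasCard-ℕ-image {P} ys ys! ys≡P = map ℤ.+_ ys , Unique.map⁺ ℤₚ.+-injective ys! , (λ x → mk⇔ (to x) (from x)) , length-map ℤ.+_ ys
  where
  to : ∀ x → x ∈ map ℤ.+_ ys → ℕ-image P x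
  to x x∈ with ∈-map⁻ ℤ.+_ x∈
  ... | m , m∈ys , x≡m = m , x≡m , Equivalence.to (ys≡P m) m∈ys
  from : ∀ x → ℕ-image P x → x ∈ map ℤ.+_ ys
  from x (m , refl , Pm) = ∈-map⁺ ℤ.+_ (Equivalence.from (ys≡P m) Pm)

HasCard-⇔ : ∀ {S T : ℤ → Set} {n} → (∀ x → S x ⇔ T x) → HasCard S n → HasCard T n
HasCard-⇔ S⇔T (xs , xs! , xs≡S , len) =
  xs , xs! , (λ x → mk⇔ (Equivalence.to (S⇔T x) ∘ Equivalence.to (xs≡S x)) (Equivalence.from (xs≡S x) ∘ Equivalence.from (S⇔T x))) , len

HasCard-interval : ∀ {P : ℕ → Set} L U → L ≤ suc U → (∀ m → P m ⇔ (L ≤ m × m ≤ U)) → HasCard (ℕ-image P) (suc U ∸ L)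
HasCard-interval {P} L U L≤1+U P⇔ =
  subst (HasCard (ℕ-image P)) (length-iterate suc L n)
    (HasCard-ℕ-image (iterate suc L n) (Ascending⇒Unique (Ascending-iterate L n)) (λ m → mk⇔ (to m) (from m)))
  where
  n = suc U ∸ L
  L+n≡1+U : L + n ≡ suc U
  L+n≡1+U = m+[n∸m]≡n L≤1+U
  to : ∀ m → m ∈ iterate suc L n → P m
  to m m∈ = let (L≤m , m<) = ∈-iterate⁻ L n m∈ in Equivalence.from (P⇔ m) (L≤m , ≤-pred (≤-trans m< (≤-reflexive L+n≡1+U)))
  from : ∀ m → P m → m ∈ iterate suc L n
  from m Pm = let (L≤m , m≤U) = Equivalence.to (P⇔ m) Pm in ∈-iterate⁺ L n L≤m (≤-trans (s≤s m≤U) (≤-reflexive (sym L+n≡1+U)))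

HasCard-punctured-interval : ∀ {P : ℕ → Set} L e U → L ≤ e → e ≤ U → (∀ m → P m ⇔ (L ≤ m × m ≤ U × m ≢ e)) →
                             HasCard (ℕ-image P) (U ∸ L)
HasCard-punctured-interval {P} L e U L≤e e≤U P⇔ =
  subst (HasCard (ℕ-image P)) length-ys (HasCard-ℕ-image ys ys! (λ m → mk⇔ (to m) (from m)))
  where
  below = iterate suc L (e ∸ L)
  above = iterate suc (suc e) (U ∸ e)
  ys = below ++ above
  L+[e∸L]≡e : L + (e ∸ L) ≡ e
  L+[e∸L]≡e = m+[n∸m]≡n L≤e
  1+e+[U∸e]≡1+U : suc e + (U ∸ e) ≡ suc U
  1+e+[U∸e]≡1+U = cong suc (m+[n∸m]≡n e≤U)
  ys! : Unique ys
  ys! = Ascending⇒Unique (Ascending-++ (subst (Ascending L below) L+[e∸L]≡e (Ascending-iterate L (e ∸ L)))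
                                        (Ascending-weaken (n≤1+n e) (Ascending-iterate (suc e) (U ∸ e))))
  length-ys : length ys ≡ U ∸ L
  length-ys = begin
    length ys                   ≡⟨ length-++ below ⟩
    length below + length above ≡⟨ cong₂ _+_ (length-iterate suc L (e ∸ L)) (length-iterate suc (suc e) (U ∸ e)) ⟩
    (e ∸ L) + (U ∸ e)           ≡⟨ +-comm (e ∸ L) (U ∸ e) ⟩
    (U ∸ e) + (e ∸ L)           ≡⟨ sym (+-∸-assoc (U ∸ e) L≤e) ⟩
    (U ∸ e) + e ∸ L             ≡⟨ cong (_∸ L) (m∸n+n≡m e≤U) ⟩
    U ∸ L                       ∎
    where open ≡-Reasoning
  to : ∀ m → m ∈ ys → P m
  to m m∈ with ∈-++⁻ below m∈
  ... | inj₁ m∈below = let (L≤m , m<) = ∈-iterate⁻ L (e ∸ L) m∈below; m<e = ≤-trans m< (≤-reflexive L+[e∸L]≡e) in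
    Equivalence.from (P⇔ m) (L≤m , <⇒≤ (≤-trans m<e e≤U) , <⇒≢ m<e)
  ... | inj₂ m∈above = let (e<m , m<) = ∈-iterate⁻ (suc e) (U ∸ e) m∈above in
    Equivalence.from (P⇔ m) (≤-trans L≤e (<⇒≤ e<m) , ≤-pred (≤-trans m< (≤-reflexive 1+e+[U∸e]≡1+U)) , >⇒≢ e<m)
  from : ∀ m → P m → m ∈ ys
  from m Pm with Equivalence.to (P⇔ m) Pm | <-cmp m e
  ... | L≤m , _ , _   | tri< m<e _ _ = ∈-++⁺ˡ (∈-iterate⁺ L (e ∸ L) L≤m (≤-trans m<e (≤-reflexive (sym L+[e∸L]≡e))))
  ... | _ , _ , m≢e   | tri≈ _ m≡e _ = contradiction m≡e m≢e
  ... | _ , m≤U , _   | tri> _ _ e<m = ∈-++⁺ʳ below (∈-iterate⁺ (suc e) (U ∸ e) e<m (≤-trans (s≤s m≤U) (≤-reflexive (sym 1+e+[U∸e]≡1+U))))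

consecutive-intervals-cover : ∀ (lo hi : ℕ → ℕ) n → (∀ j → j < n → lo (suc j) ≤ suc (hi j)) →
                              ∀ x → lo 0 ≤ x → x ≤ hi n → Σ ℕ λ j → j ≤ n × lo j ≤ x × x ≤ hi j
consecutive-intervals-cover lo hi zero _ x lo≤x x≤hi = 0 , z≤n , lo≤x , x≤hi
consecutive-intervals-cover lo hi (suc n) linked x lo≤x x≤hi with x ≤? hi n
... | yes x≤hi[n] =
  let (j , j≤n , P) = consecutive-intervals-cover lo hi n (λ j j<n → linked j (m≤n⇒m≤1+n j<n)) x lo≤x x≤hi[n]
  in j , m≤n⇒m≤1+n j≤n , P
... | no x≰hi[n] = suc n , ≤-refl , ≤-trans (linked n ≤-refl) (≰⇒> x≰hi[n]) , x≤hi

+[m∸n]≡+m-+n : ∀ {m n} → n ≤ m → ℤ.+ (m ∸ n) ≡ ℤ.+ m -ℤ ℤ.+ n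
+[m∸n]≡+m-+n {m} {n} n≤m = sym (trans (ℤₚ.m-n≡m⊖n m n) (ℤₚ.⊖-≥ n≤m))

CardIs-cong : ∀ {S : ℤ → Set} {m n} → CardIs S m → m ≡ n → CardIs S n
CardIs-cong (c , hasCard , c≡m) m≡n = c , hasCard , trans c≡m m≡n

sumℤ-map-+ : ∀ ms → sumℤ (map ℤ.+_ ms) ≡ ℤ.+ sum ms
sumℤ-map-+ [] = refl
sumℤ-map-+ (m ∷ ms) = cong (_+ℤ_ (ℤ.+ m)) (sumℤ-map-+ ms)

-- The restricted sumset h^A

module SumsetA (h k p : ℕ) (3≤h : 3 ≤ h) (3h+3≤k : 3 * h + 3 ≤ k) (4≤p : 4 ≤ p) (p<k : p < k) where

  open Enumeration p 4≤p

  A : ℤ → Set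
  A = SetA k (suc p)

  Sumset : ℤ → Set
  Sumset = RestrictedSumset h A

  σ : List ℕ → ℕ
  σ C = sum (map (enum p) C)

  IsSelection : List ℕ → Set
  IsSelection C = Unique C × All (_< k) C × length C ≡ h

  Representable : ℕ → Set
  Representable m = Σ (List ℕ) λ C → Ascending 0 C k × length C ≡ h × σ C ≡ m

  D : ℕ
  D = k ∸ h

  2h+3≤D : 2 * h + 3 ≤ D
  2h+3≤D = ≤-trans (≤-reflexive (sym (m+n∸n≡m (2 * h + 3) h))) (∸-monoˡ-≤ h (≤-trans (≤-reflexive (lemma h)) 3h+3≤k))
    where
    lemma : ∀ h → 2 * h + 3 + h ≡ 3 * h + 3
    lemma = solve-∀

  h<2h+3 : h < 2 * h + 3
  h<2h+3 = ≤-trans (s≤s (≤-trans (m≤m+n h (h + 0)) (m≤m+n _ 2))) (≤-reflexive (lemma h))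
    where
    lemma : ∀ h → suc (h + (h + 0) + 2) ≡ 2 * h + 3
    lemma = solve-∀

  h<D : h < D
  h<D = ≤-trans h<2h+3 2h+3≤D

  9≤D : 9 ≤ D
  9≤D = ≤-trans (+-monoˡ-≤ 3 (*-monoʳ-≤ 2 3≤h)) 2h+3≤D

  h≤k : h ≤ k
  h≤k = ≤-trans (<⇒≤ h<D) (m∸n≤m k h)

  D+h≡k : D + h ≡ k
  D+h≡k = m∸n+n≡m h≤k

  enum∈A : ∀ {c} → c < k → A (ℤ.+ enum p c)
  enum∈A {c} c<k = ℤ.+≤+ z≤n , ℤ.+≤+ (≤-trans (enum-≤ c) (≤-trans (s≤s c<k) (≤-reflexive (+-comm 1 k)))) ,
                   enum≢2 c ∘ ℤₚ.+-injective , enum≢1+p c ∘ ℤₚ.+-injective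

  enum-preimage : ∀ b → b ≤ suc k → b ≢ 2 → b ≢ suc p → Σ ℕ λ c → c < k × enum p c ≡ b
  enum-preimage b b≤1+k b≢2 b≢1+p with enum-surjective b b≢2 b≢1+p
  ... | c , ec≡b with c <? k
  ...   | yes c<k = c , c<k , ec≡b
  ...   | no c≮k  = contradiction (≤-trans (enum-mono (≮⇒≥ c≮k)) (≤-reflexive ec≡b))
                                  (<⇒≱ (≤-trans (s≤s b≤1+k) (≤-reflexive (sym (enum-high (<⇒≤ p<k))))))

  Representable⇒Sumset : ∀ {m} → Representable m → Sumset (ℤ.+ m)
  Representable⇒Sumset (C , asc , len , σC≡m) =
    map ℤ.+_ (map (enum p) C) ,
    Unique.map⁺ ℤₚ.+-injective (Unique.map⁺ enum-injective (Ascending⇒Unique asc)) ,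
    All.map⁺ (All.map⁺ (All.map (enum∈A ∘ proj₂) (Ascending⇒bounded asc))) ,
    trans (length-map ℤ.+_ (map (enum p) C)) (trans (length-map (enum p) C) len) ,
    trans (sumℤ-map-+ (map (enum p) C)) (cong ℤ.+_ σC≡m)

  Sumset⇒selection : ∀ {x} → Sumset x → Σ (List ℕ) λ C → IsSelection C × x ≡ ℤ.+ σ C
  Sumset⇒selection (B , B! , B⊆A , len , ΣB≡x) with preimage B B⊆A
    where
    preimage : ∀ B → All A B → Σ (List ℕ) λ C → map ℤ.+_ (map (enum p) C) ≡ B × All (_< k) C
    preimage [] [] = [] , refl , []
    preimage (ℤ.+ b ∷ B) ((_ , b≤1+k , b≢2 , b≢1+p) ∷ B⊆A) with
      enum-preimage b (≤-trans (ℤ.drop‿+≤+ b≤1+k) (≤-reflexive (+-comm k 1))) (b≢2 ∘ cong (ℤ.+_)) (b≢1+p ∘ cong (ℤ.+_))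
    ... | c , c<k , ec≡b = let (C , C↦B , C<k) = preimage B B⊆A in
                           c ∷ C , cong₂ _∷_ (cong ℤ.+_ ec≡b) C↦B , c<k ∷ C<k
    preimage (ℤ.-[1+ _ ] ∷ _) ((() , _) ∷ _)
  ... | C , refl , C<k =
    C , (Unique.map⁻ (Unique.map⁻ B!) , C<k , trans (sym (trans (length-map ℤ.+_ (map (enum p) C)) (length-map (enum p) C))) len) ,
    trans (sym ΣB≡x) (sumℤ-map-+ (map (enum p) C))

  L U : ℕ
  L = blockSum 0 h
  U = blockSum D h

  selection-bounds : ∀ {C} → IsSelection C → L ≤ σ C × σ C ≤ U
  selection-bounds {C} (C! , C<k , len) =
    subst (λ l → blockSum 0 l ≤ σ C) len (initialBlock≤sum k C C! C<k) ,
    subst (λ l → σ C ≤ blockSum (k ∸ l) l) len (sum≤finalBlock k C C! C<k)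

  data Gap (m : ℕ) : Set where
    gap-above-min : p ≡ h → m ≡ suc L → Gap m
    gap-below-max : p ≡ D → suc m ≡ U → Gap m
    gap-h≡3       : h ≡ 3 → p ≡ 4 → m ≡ 2 + L → Gap m

  -- When y = h + 1, the minimum L is attained only by [0, h), whose largest element h - 1 has the
  -- image h; replacing any element by one ≥ h raises the sum by at least 2.
  σ≢1+L : ∀ {C} → IsSelection C → p ≡ h → σ C ≢ suc L
  σ≢1+L {C} (C! , C<k , len) p≡h σC≡1+L with pick-if (enum p) (h ≤?_) C C!
  ... | inj₁ none≥h = <-irrefl refl (≤-trans (≤-reflexive (sym σC≡1+L)) σC≤L)
    where
    σC≤L : σ C ≤ L
    σC≤L = ≤-trans (subst (λ l → σ C ≤ blockSum (h ∸ l) l) len (sum≤finalBlock h C C! (All.map ≰⇒> none≥h)))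
                   (≤-reflexive (cong (λ o → blockSum o h) (n∸n≡0 h)))
  ... | inj₂ (c , h≤c , removal) = <-irrefl refl (≤-trans 2+L≤σC (≤-reflexive σC≡1+L))
    where
    open Removal removal
    l = length rest
    1+l≡h : suc l ≡ h
    1+l≡h = trans (sym length-rest) len
    enum-l : enum p l ≡ h
    enum-l = trans (enum-mid (≤-pred (≤-trans 3≤h (≤-reflexive (sym 1+l≡h)))) (≤-trans (≤-reflexive 1+l≡h) (≤-reflexive (sym p≡h)))) 1+l≡h
    2+L≤σC : 2 + L ≤ σ C
    2+L≤σC = begin
      2 + blockSum 0 h                 ≡⟨ cong (λ n → 2 + blockSum 0 n) (sym 1+l≡h) ⟩
      2 + blockSum 0 (suc l)           ≡⟨ cong (2 +_) (blockSum-snoc 0 l) ⟩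
      2 + (blockSum 0 l + enum p l)    ≡⟨ cong (λ e → 2 + (blockSum 0 l + e)) enum-l ⟩
      2 + (blockSum 0 l + h)           ≡⟨ x∙yz≈y∙xz 2 _ h ⟩
      blockSum 0 l + (2 + h)           ≡⟨ +-comm _ (2 + h) ⟩
      2 + h + blockSum 0 l             ≤⟨ +-mono-≤ (≤-trans (≤-reflexive (sym (enum-high (≤-reflexive p≡h)))) (enum-mono h≤c))
                                                   (initialBlock≤sum k rest rest-unique (All.map proj₁ (restrict C<k))) ⟩
      enum p c + σ rest                ≡⟨ sym sum-rest ⟩
      σ C                              ∎
      where open ≤-Reasoning

  -- Dually, when y = k - h + 1 the maximum U is attained only by [D, k), where D = k - h is the
  -- smallest element and has the image D + 2; replacing any element by one < D lowers the sum by at least 2.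
  σ+1≢U : ∀ {C} → IsSelection C → p ≡ D → suc (σ C) ≢ U
  σ+1≢U {C} (C! , C<k , len) p≡D 1+σC≡U with pick-if (enum p) (_<? D) C C!
  ... | inj₁ none<D = <⇒≱ (≤-reflexive 1+σC≡U) U≤σC
    where
    C≥D : All (λ c → D ≤ c × c < D + h) C
    C≥D = All.zipWith (λ (c≮D , c<k) → ≮⇒≥ c≮D , ≤-trans c<k (≤-reflexive (sym D+h≡k))) (none<D , C<k)
    U≤σC : U ≤ σ C
    U≤σC = subst (λ l → blockSum D l ≤ σ C) len (proj₂ (length≤∧blockSum≤sum h D C C! C≥D))
  ... | inj₂ (c , c<D , removal) = <⇒≢ 1+σC<U 1+σC≡U
    where
    open Removal removal
    l = length rest
    1+l≡h : suc l ≡ h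
    1+l≡h = trans (sym length-rest) len
    k∸l≡1+D : k ∸ l ≡ suc D
    k∸l≡1+D = begin
      k ∸ l             ≡⟨ cong (_∸ l) (sym D+h≡k) ⟩
      D + h ∸ l         ≡⟨ cong (λ n → D + n ∸ l) (sym 1+l≡h) ⟩
      D + suc l ∸ l     ≡⟨ +-∸-assoc D (n≤1+n l) ⟩
      D + (suc l ∸ l)   ≡⟨ cong (D +_) (m+n∸n≡m 1 l) ⟩
      D + 1             ≡⟨ +-comm D 1 ⟩
      suc D             ∎
      where open ≡-Reasoning
    σrest≤ : σ rest ≤ blockSum (suc D) l
    σrest≤ = subst (λ o → σ rest ≤ blockSum o l) k∸l≡1+D (sum≤finalBlock k rest rest-unique (All.map proj₁ (restrict C<k)))
    1+σC<U : suc (σ C) < U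
    1+σC<U = begin-strict
      suc (σ C)                        ≡⟨ cong suc sum-rest ⟩
      suc (enum p c + σ rest)          ≤⟨ s≤s (+-mono-≤ (≤-trans (enum-<p (≤-trans c<D (≤-reflexive (sym p≡D)))) c<D) σrest≤) ⟩
      suc (D + blockSum (suc D) l)     <⟨ n<1+n _ ⟩
      2 + D + blockSum (suc D) l       ≡⟨ cong (_+ blockSum (suc D) l) (sym (enum-high (≤-reflexive p≡D))) ⟩
      blockSum D (suc l)               ≡⟨ cong (blockSum D) 1+l≡h ⟩
      U                                ∎
      where open ≤-Reasoning

  σ≢2+L : ∀ {C} → IsSelection C → h ≡ 3 → p ≡ 4 → σ C ≢ 2 + L
  σ≢2+L {C} (C! , C<k , len) h≡3 p≡4 σC≡2+L = σC≢6 (trans σC≡2+L (cong (2 +_) (trans (cong (blockSum 0) h≡3) blockSum-0-3)))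
    where
    σC≢6 : σ C ≢ 6
    σC≢6 with pick-if (enum p) (4 ≤?_) C C!
    ... | inj₁ none≥4 = sum-enum4≢6 C C! (All.map ≰⇒> none≥4) (trans len h≡3) ∘ subst (λ q → sum (map (enum q) C) ≡ 6) p≡4
    ... | inj₂ (c , 4≤c , removal) = >⇒≢ 6<σC
      where
      open Removal removal
      1≤σrest : 1 ≤ σ rest
      1≤σrest = ≤-trans (≤-reflexive (sym blockSum-0-2))
                        (subst (λ l → blockSum 0 l ≤ σ rest) (suc-injective (trans (sym length-rest) (trans len h≡3)))
                               (initialBlock≤sum k rest rest-unique (All.map proj₁ (restrict C<k))))
      6<σC : 6 < σ C
      6<σC = ≤-trans (+-mono-≤ (≤-trans (≤-reflexive (sym (enum-high (≤-reflexive p≡4)))) (enum-mono 4≤c)) 1≤σrest)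
                     (≤-reflexive (sym sum-rest))

  framed-Representable : ∀ a mid K′ b → Ascending a mid K′ → a + (length mid + b) ≡ h → K′ + b ≡ k →
                         Representable (blockSum 0 a + (σ mid + blockSum K′ b))
  framed-Representable a mid K′ b asc length≡h K′+b≡k = low ++ mid ++ high , ascending , length≡h′ , σ≡
    where
    low = iterate suc 0 a
    high = iterate suc K′ b
    ascending : Ascending 0 (low ++ mid ++ high) k
    ascending = Ascending-++ (Ascending-iterate 0 a) (Ascending-++ asc (subst (Ascending K′ high) K′+b≡k (Ascending-iterate K′ b)))
    length≡h′ : length (low ++ mid ++ high) ≡ h
    length≡h′ = begin
      length (low ++ mid ++ high)                  ≡⟨ length-++ low ⟩
      length low + length (mid ++ high)            ≡⟨ cong (length low +_) (length-++ mid) ⟩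
      length low + (length mid + length high)      ≡⟨ cong₂ (λ x y → x + (length mid + y)) (length-iterate suc 0 a) (length-iterate suc K′ b) ⟩
      a + (length mid + b)                         ≡⟨ length≡h ⟩
      h                                            ∎
      where open ≡-Reasoning
    σ≡ : σ (low ++ mid ++ high) ≡ blockSum 0 a + (σ mid + blockSum K′ b)
    σ≡ = trans (sum-map-++ (enum p) low (mid ++ high)) (cong (blockSum 0 a +_) (sum-map-++ (enum p) mid high))

  -- A frame is the h-subset [0, a) ∪ {t} ∪ [K + 1, K + b] of [0, k) with a ≤ t ≤ K; frameSum a b K (enum p t)
  -- is its sum.
  record Frame (a b K : ℕ) : Set where
    field
      size-h : suc (a + b) ≡ h
      size-k : suc (K + b) ≡ k

  frameSum : ℕ → ℕ → ℕ → ℕ → ℕ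
  frameSum a b K r = blockSum 0 a + blockSum (suc K) b + r

  Frame⇒2h+3≤K : ∀ {a b K} → Frame a b K → 2 * h + 3 ≤ K
  Frame⇒2h+3≤K {a} {b} {K} F = +-cancelʳ-≤ h (2 * h + 3) K (begin
    2 * h + 3 + h  ≡⟨ lemma h ⟩
    3 * h + 3      ≤⟨ 3h+3≤k ⟩
    k              ≡⟨ sym size-k ⟩
    suc (K + b)    ≡⟨ sym (+-suc K b) ⟩
    K + suc b      ≤⟨ +-monoʳ-≤ K (≤-trans (s≤s (m≤n+m b a)) (≤-reflexive size-h)) ⟩
    K + h          ∎)
    where
    open Frame F
    open ≤-Reasoning
    lemma : ∀ h → 2 * h + 3 + h ≡ 3 * h + 3
    lemma = solve-∀

  Frame⇒9≤K : ∀ {a b K} → Frame a b K → 9 ≤ K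
  Frame⇒9≤K F = ≤-trans (+-monoˡ-≤ 3 (*-monoʳ-≤ 2 3≤h)) (Frame⇒2h+3≤K F)

  framed-pair : ∀ {a b K x z} → Frame a (suc b) K → a ≤ x → x < z → z ≤ K →
                Representable (blockSum 0 a + ((enum p x + (enum p z + 0)) + blockSum (2 + K) b))
  framed-pair {a} {b} {K} F a≤x x<z z≤K =
    framed-Representable a (_ ∷ _ ∷ []) (2 + K) b (cons a≤x (cons x<z (nil (s≤s (m≤n⇒m≤1+n z≤K)))))
      (trans (cong (a +_) (sym (+-suc 1 b))) (trans (+-suc a (suc b)) size-h)) (trans (cong suc (sym (+-suc K b))) size-k)
    where open Frame F

  free-element : ∀ {a b K t} → Frame a b K → a ≤ t → t ≤ K → Representable (frameSum a b K (enum p t))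
  free-element {a} {b} {K} {t} F a≤t t≤K =
    subst Representable (lemma (blockSum 0 a) (enum p t) (blockSum (suc K) b))
      (framed-Representable a (t ∷ []) (suc K) b (cons a≤t (nil (s≤s t≤K))) (trans (+-suc a b) size-h) size-k)
    where
    open Frame F
    lemma : ∀ x e s → x + ((e + 0) + s) ≡ x + s + e
    lemma = solve-∀

  -- The free index and the bottom index K + 1 of the final block are traded for 3 and K when K + 1 = p,
  -- and for 2 and K otherwise.
  frame-value-2 : ∀ {a b K} → Frame a b K → a ≤ 1 → Representable (frameSum a b K 2)
  frame-value-2 {a} {zero} F a≤1 = contradiction (≤-trans 3≤h (≤-reflexive (sym (Frame.size-h F))))
                                                 (<⇒≱ (s≤s (s≤s (≤-trans (≤-reflexive (+-identityʳ a)) a≤1))))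
  frame-value-2 {a} {suc b} {K} F a≤1 with suc K ≟ p
  ... | yes 1+K≡p = subst Representable value (framed-pair F (m≤n⇒m≤o+n 2 a≤1) 3<K ≤-refl)
    where
    3<K = ≤-trans (s≤s (s≤s (s≤s (s≤s z≤n)))) (Frame⇒9≤K F)
    x = blockSum 0 a
    s = blockSum (2 + K) b
    lemma : ∀ x K s → x + ((4 + (suc K + 0)) + s) ≡ x + ((2 + suc K) + s) + 2
    lemma = solve-∀
    value : x + ((enum p 3 + (enum p K + 0)) + s) ≡ frameSum a (suc b) K 2
    value = begin
      x + ((enum p 3 + (enum p K + 0)) + s) ≡⟨ cong₂ (λ u v → x + ((u + (v + 0)) + s))
                                                (enum-mid (s≤s (s≤s z≤n)) 4≤p) (enum-mid (≤-trans (s≤s (s≤s z≤n)) (<⇒≤ 3<K)) (≤-reflexive 1+K≡p)) ⟩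
      x + ((4 + (suc K + 0)) + s)           ≡⟨ lemma x K s ⟩
      x + ((2 + suc K) + s) + 2             ≡⟨ cong (λ u → x + (u + s) + 2) (sym (enum-high (≤-reflexive (sym 1+K≡p)))) ⟩
      x + (enum p (suc K) + s) + 2          ∎
      where open ≡-Reasoning
  ... | no 1+K≢p = subst Representable value (framed-pair F (m≤n⇒m≤o+n 1 a≤1) 2<K ≤-refl)
    where
    2<K = ≤-trans (s≤s (s≤s (s≤s z≤n))) (Frame⇒9≤K F)
    x = blockSum 0 a
    s = blockSum (2 + K) b
    lemma : ∀ x e s → x + ((3 + (e + 0)) + s) ≡ x + (suc e + s) + 2
    lemma = solve-∀
    1+K≢2 : suc K ≢ 2
    1+K≢2 1+K≡2 = <⇒≱ (s≤s (s≤s z≤n)) (≤-trans 2<K (≤-reflexive (suc-injective 1+K≡2)))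
    value : x + ((enum p 2 + (enum p K + 0)) + s) ≡ frameSum a (suc b) K 2
    value = begin
      x + ((enum p 2 + (enum p K + 0)) + s) ≡⟨ cong (λ u → x + ((u + (enum p K + 0)) + s)) (enum-mid ≤-refl 2<p) ⟩
      x + ((3 + (enum p K + 0)) + s)        ≡⟨ lemma x (enum p K) s ⟩
      x + (suc (enum p K) + s) + 2          ≡⟨ cong (λ u → x + (u + s) + 2) (sym (enum-suc 1+K≢2 1+K≢p)) ⟩
      x + (enum p (suc K) + s) + 2          ∎
      where open ≡-Reasoning

  -- The free index and K + 1 are traded for p and K.
  frame-value-1+p-pair : ∀ {a b K} → Frame a (suc b) K → a ≤ p → p < K → Representable (frameSum a (suc b) K (suc p))
  frame-value-1+p-pair {a} {b} {K} F a≤p p<K = subst Representable value (framed-pair F a≤p p<K ≤-refl)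
    where
    x = blockSum 0 a
    s = blockSum (2 + K) b
    lemma : ∀ x p K s → x + ((2 + p + (2 + K + 0)) + s) ≡ x + ((2 + suc K) + s) + suc p
    lemma = solve-∀
    value : x + ((enum p p + (enum p K + 0)) + s) ≡ frameSum a (suc b) K (suc p)
    value = begin
      x + ((enum p p + (enum p K + 0)) + s) ≡⟨ cong₂ (λ u v → x + ((u + (v + 0)) + s)) (enum-high ≤-refl) (enum-high (<⇒≤ p<K)) ⟩
      x + ((2 + p + (2 + K + 0)) + s)       ≡⟨ lemma x p K s ⟩
      x + ((2 + suc K) + s) + suc p         ≡⟨ cong (λ u → x + (u + s) + suc p) (sym (enum-high (m≤n⇒m≤1+n (<⇒≤ p<K)))) ⟩
      x + (enum p (suc K) + s) + suc p      ∎
      where open ≡-Reasoning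

  -- The free index and the top index a of the initial block are traded for a + 1 and p - 1.
  frame-value-1+p-shift : ∀ {a b K} → Frame (suc a) b K → suc a ≢ 2 → suc (suc a) < p → p ≤ K →
                          Representable (frameSum (suc a) b K (suc p))
  frame-value-1+p-shift {a} {b} {K} F 1+a≢2 2+a<p p≤K = subst Representable value
    (framed-Representable a (suc a ∷ pred p ∷ []) (suc K) b (cons (n≤1+n a) (cons 2+a≤pred[p] (nil (s≤s pred[p]≤K))))
      (trans (+-suc a (suc b)) (trans (cong suc (+-suc a b)) size-h)) size-k)
    where
    open Frame F
    1+pred[p]≡p : suc (pred p) ≡ p
    1+pred[p]≡p = suc-pred p {{>-nonZero (≤-trans (s≤s z≤n) 4≤p)}}
    2+a≤pred[p] : suc (suc a) ≤ pred p
    2+a≤pred[p] = ≤-pred (≤-trans 2+a<p (≤-reflexive (sym 1+pred[p]≡p)))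
    pred[p]≤K : pred p ≤ K
    pred[p]≤K = ≤-trans (n≤1+n _) (≤-trans (≤-reflexive 1+pred[p]≡p) p≤K)
    enum-1+a : enum p (suc a) ≡ suc (enum p a)
    enum-1+a = enum-suc 1+a≢2 (<⇒≢ (<-trans (n<1+n _) 2+a<p))
    enum-pred[p] : enum p (pred p) ≡ p
    enum-pred[p] = trans (enum-mid (≤-trans (s≤s (s≤s z≤n)) 2+a≤pred[p]) (≤-reflexive 1+pred[p]≡p)) 1+pred[p]≡p
    x = blockSum 0 a
    s = blockSum (suc K) b
    lemma : ∀ x e p s → x + ((suc e + (p + 0)) + s) ≡ x + e + s + suc p
    lemma = solve-∀
    value : x + ((enum p (suc a) + (enum p (pred p) + 0)) + s) ≡ frameSum (suc a) b K (suc p)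
    value = begin
      x + ((enum p (suc a) + (enum p (pred p) + 0)) + s) ≡⟨ cong₂ (λ u v → x + ((u + (v + 0)) + s)) enum-1+a enum-pred[p] ⟩
      x + ((suc (enum p a) + (p + 0)) + s)               ≡⟨ lemma x (enum p a) p s ⟩
      x + enum p a + s + suc p                           ≡⟨ cong (λ u → u + s + suc p) (sym (blockSum-snoc 0 a)) ⟩
      blockSum 0 (suc a) + s + suc p                     ∎
      where open ≡-Reasoning

  -- The free index and the index 1 are traded for 2 and p - 2.
  frame-value-1+p-a≡2 : ∀ {b K} → Frame 2 b K → 5 ≤ p → p ≤ K → Representable (frameSum 2 b K (suc p))
  frame-value-1+p-a≡2 {b} {K} F 5≤p p≤K = subst Representable value
    (framed-Representable 1 (2 ∷ p ∸ 2 ∷ []) (suc K) b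
      (cons (s≤s z≤n) (cons 3≤p∸2 (nil (s≤s (≤-trans (m∸n≤m p 2) p≤K))))) size-h size-k)
    where
    open Frame F
    2+[p∸2]≡p : 2 + (p ∸ 2) ≡ p
    2+[p∸2]≡p = m+[n∸m]≡n (<⇒≤ 2<p)
    3≤p∸2 : 3 ≤ p ∸ 2
    3≤p∸2 = ≤-pred (≤-pred (≤-trans 5≤p (≤-reflexive (sym 2+[p∸2]≡p))))
    enum-p∸2 : enum p (p ∸ 2) ≡ suc (p ∸ 2)
    enum-p∸2 = enum-mid (≤-trans (s≤s (s≤s z≤n)) 3≤p∸2) (≤-trans (s≤s (m≤n+m _ 1)) (≤-reflexive 2+[p∸2]≡p))
    s = blockSum (suc K) b
    lemma : ∀ q s → (0 + 0) + ((3 + (suc q + 0)) + s) ≡ 1 + s + suc (2 + q)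
    lemma = solve-∀
    value : blockSum 0 1 + ((enum p 2 + (enum p (p ∸ 2) + 0)) + s) ≡ frameSum 2 b K (suc p)
    value = begin
      (enum p 0 + 0) + ((enum p 2 + (enum p (p ∸ 2) + 0)) + s) ≡⟨ cong₂ (λ u v → (u + 0) + ((v + (enum p (p ∸ 2) + 0)) + s))
                                                                         (enum-low (s≤s z≤n)) (enum-mid ≤-refl 2<p) ⟩
      (0 + 0) + ((3 + (enum p (p ∸ 2) + 0)) + s)                ≡⟨ cong (λ w → (0 + 0) + ((3 + (w + 0)) + s)) enum-p∸2 ⟩
      (0 + 0) + ((3 + (suc (p ∸ 2) + 0)) + s)                   ≡⟨ lemma (p ∸ 2) s ⟩
      1 + s + suc (2 + (p ∸ 2))                                 ≡⟨ cong₂ (λ u v → u + s + suc v) (sym blockSum-0-2) 2+[p∸2]≡p ⟩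
      blockSum 0 2 + s + suc p                                  ∎
      where open ≡-Reasoning

  pair-or-gap : ∀ {a b K} → Frame a b K → a ≤ p → p ≤ K →
                (b ≡ 0 ⊎ K ≡ p → Gap (frameSum a b K (suc p))) → ¬ Gap (frameSum a b K (suc p)) →
                Representable (frameSum a b K (suc p))
  pair-or-gap {b = zero} F a≤p p≤K gap no-gap = contradiction (gap (inj₁ refl)) no-gap
  pair-or-gap {b = suc b} {K} F a≤p p≤K gap no-gap with p <? K
  ... | yes p<K = frame-value-1+p-pair F a≤p p<K
  ... | no p≮K  = contradiction (gap (inj₂ (≤-antisym (≮⇒≥ p≮K) p≤K))) no-gap

  frame-value-1+p : ∀ {a b K} → Frame a b K → a < p → p ≤ K → ¬ Gap (frameSum a b K (suc p)) →
              Representable (frameSum a b K (suc p))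
  frame-value-1+p {zero} {b} {K} F a<p p≤K no-gap = pair-or-gap F (<⇒≤ a<p) p≤K gap no-gap
    where
    open Frame F
    gap : b ≡ 0 ⊎ K ≡ p → Gap (frameSum 0 b K (suc p))
    gap (inj₁ refl) = contradiction (≤-trans 3≤h (≤-reflexive (sym size-h))) (λ { (s≤s ()) })
    gap (inj₂ refl) = gap-below-max K≡D (trans (lemma (blockSum (suc K) b) K) (sym U≡))
      where
      K≡D : K ≡ D
      K≡D = trans (sym (m+n∸n≡m K b)) (cong₂ _∸_ size-k size-h)
      U≡ : U ≡ 2 + K + blockSum (suc K) b
      U≡ = trans (cong₂ blockSum (sym K≡D) (sym size-h)) (cong (_+ blockSum (suc K) b) (enum-high ≤-refl))
      lemma : ∀ s K → suc (0 + s + suc K) ≡ 2 + K + s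
      lemma = solve-∀
  frame-value-1+p {suc zero} F a<p p≤K _ = frame-value-1+p-shift F (λ ()) (≤-trans (s≤s (s≤s (s≤s z≤n))) 4≤p) p≤K
  frame-value-1+p {suc (suc zero)} {b} {K} F a<p p≤K no-gap with 5 ≤? p
  ... | yes 5≤p = frame-value-1+p-a≡2 F 5≤p p≤K
  ... | no 5≰p  = pair-or-gap F (<⇒≤ a<p) p≤K gap no-gap
    where
    open Frame F
    p≡4 : p ≡ 4
    p≡4 = ≤-antisym (≤-pred (≰⇒> 5≰p)) 4≤p
    gap : b ≡ 0 ⊎ K ≡ p → Gap (frameSum 2 b K (suc p))
    gap (inj₁ refl) = gap-h≡3 (sym size-h) p≡4 (begin
      blockSum 0 2 + 0 + suc p ≡⟨ cong₂ (λ u v → u + 0 + suc v) blockSum-0-2 p≡4 ⟩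
      6                        ≡⟨ cong (2 +_) (sym blockSum-0-3) ⟩
      2 + blockSum 0 3         ≡⟨ cong (λ n → 2 + blockSum 0 n) size-h ⟩
      2 + L                    ∎)
      where open ≡-Reasoning
    gap (inj₂ K≡p) = contradiction (≤-trans (Frame⇒9≤K F) (≤-reflexive (trans K≡p p≡4))) (λ { (s≤s (s≤s (s≤s (s≤s ())))) })
  frame-value-1+p {a@(suc (suc (suc _)))} {b} {K} F a<p p≤K no-gap with suc a <? p
  ... | yes 1+a<p = frame-value-1+p-shift F (λ ()) 1+a<p p≤K
  ... | no 1+a≮p  = pair-or-gap F (<⇒≤ a<p) p≤K gap no-gap
    where
    open Frame F
    1+a≡p : suc a ≡ p
    1+a≡p = ≤-antisym a<p (≮⇒≥ 1+a≮p)
    gap : b ≡ 0 ⊎ K ≡ p → Gap (frameSum a b K (suc p))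
    gap (inj₁ refl) = gap-above-min (trans (sym 1+a≡p) (trans (cong suc (sym (+-identityʳ a))) size-h)) (begin
      blockSum 0 a + 0 + suc p       ≡⟨ lemma (blockSum 0 a) p ⟩
      suc (blockSum 0 a + p)         ≡⟨ cong (λ e → suc (blockSum 0 a + e)) (sym (trans (enum-mid (s≤s (s≤s z≤n)) a<p) 1+a≡p)) ⟩
      suc (blockSum 0 a + enum p a)  ≡⟨ cong suc (sym (blockSum-snoc 0 a)) ⟩
      suc (blockSum 0 (suc a))       ≡⟨ cong (λ n → suc (blockSum 0 n)) (trans (cong suc (sym (+-identityʳ a))) size-h) ⟩
      suc L                          ∎)
      where
      open ≡-Reasoning
      lemma : ∀ x p → x + 0 + suc p ≡ suc (x + p)
      lemma = solve-∀
    gap (inj₂ K≡p) = contradiction (≤-trans (Frame⇒2h+3≤K F) (≤-reflexive K≡p)) (<⇒≱ (≤-trans (s≤s p≤h) h<2h+3))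
      where
      p≤h : p ≤ h
      p≤h = ≤-trans (≤-reflexive (sym 1+a≡p)) (≤-trans (s≤s (m≤m+n a b)) (≤-reflexive size-h))

  frame-attains : ∀ {a b K} → Frame a b K → ∀ r → enum p a ≤ r → r ≤ enum p K → ¬ Gap (frameSum a b K r) →
                  Representable (frameSum a b K r)
  frame-attains {a} {b} {K} F r ea≤r r≤eK no-gap with r ≟ 2 | r ≟ suc p
  ... | yes refl | _ = frame-value-2 F a≤1
    where
    a≤1 : a ≤ 1
    a≤1 with a ≤? 1
    ... | yes a≤1 = a≤1
    ... | no a≰1  = contradiction (≤-trans (≤-reflexive (sym (enum-mid ≤-refl 2<p))) (≤-trans (enum-mono (≰⇒> a≰1)) ea≤r))
                                  (λ { (s≤s (s≤s ())) })
  ... | no _ | yes refl = frame-value-1+p F a<p p≤K no-gap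
    where
    a<p : a < p
    a<p with a <? p
    ... | yes a<p = a<p
    ... | no a≮p = contradiction (≤-trans (≤-reflexive (sym (enum-high (≮⇒≥ a≮p)))) ea≤r) (<⇒≱ (s≤s (s≤s (≮⇒≥ a≮p))))
    p≤K : p ≤ K
    p≤K with p ≤? K
    ... | yes p≤K = p≤K
    ... | no p≰K = contradiction (≤-trans r≤eK (enum-<p (≰⇒> p≰K))) (<⇒≱ (s≤s (≰⇒> p≰K)))
  ... | no r≢2 | no r≢1+p with enum-surjective r r≢2 r≢1+p
  ...   | t , et≡r = subst (Representable ∘ frameSum a b K) et≡r
                       (free-element {t = t} F (enum-cancel-≤ (≤-trans ea≤r (≤-reflexive (sym et≡r))))
                                               (enum-cancel-≤ (≤-trans (≤-reflexive et≡r) r≤eK)))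

  chunk-frame : ∀ {j} → j < h → Frame (h ∸ suc j) j (k ∸ suc j)
  chunk-frame {j} j<h = record
    { size-h = trans (sym (+-suc _ j)) (m∸n+n≡m j<h)
    ; size-k = trans (sym (+-suc _ j)) (m∸n+n≡m (≤-trans j<h h≤k)) }

  chunk-min chunk-max : ℕ → ℕ
  chunk-min j = frameSum (h ∸ suc j) j (k ∸ suc j) (enum p (h ∸ suc j))
  chunk-max j = frameSum (h ∸ suc j) j (k ∸ suc j) (enum p (k ∸ suc j))

  h∸1+1≡h : suc (h ∸ 1) ≡ h
  h∸1+1≡h = sym (∸-≡suc∸suc (≤-trans (s≤s z≤n) 3≤h))

  chunk-min-first : chunk-min 0 ≡ L
  chunk-min-first = begin
    blockSum 0 (h ∸ 1) + 0 + enum p (h ∸ 1) ≡⟨ cong (_+ enum p (h ∸ 1)) (+-identityʳ (blockSum 0 (h ∸ 1))) ⟩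
    blockSum 0 (h ∸ 1) + enum p (h ∸ 1)     ≡⟨ sym (blockSum-snoc 0 (h ∸ 1)) ⟩
    blockSum 0 (suc (h ∸ 1))                ≡⟨ cong (blockSum 0) h∸1+1≡h ⟩
    L                                       ∎
    where open ≡-Reasoning

  chunk-max-last : chunk-max (h ∸ 1) ≡ U
  chunk-max-last = begin
    chunk-max (h ∸ 1)
      ≡⟨ cong (λ n → blockSum 0 (h ∸ n) + blockSum (suc (k ∸ n)) (h ∸ 1) + enum p (k ∸ n)) h∸1+1≡h ⟩
    blockSum 0 (h ∸ h) + blockSum (suc D) (h ∸ 1) + enum p D
      ≡⟨ cong (λ n → blockSum 0 n + blockSum (suc D) (h ∸ 1) + enum p D) (n∸n≡0 h) ⟩
    blockSum (suc D) (h ∸ 1) + enum p D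
      ≡⟨ +-comm (blockSum (suc D) (h ∸ 1)) _ ⟩
    blockSum D (suc (h ∸ 1))
      ≡⟨ cong (blockSum D) h∸1+1≡h ⟩
    U ∎
    where open ≡-Reasoning

  chunks-adjacent : ∀ j → j < h ∸ 1 → chunk-min (suc j) ≡ chunk-max j
  chunks-adjacent j j<h∸1 = begin
    x + (g + s) + e            ≡⟨ lemma x g s e ⟩
    x + e + s + g              ≡⟨ cong (λ u → u + s + g) (sym (blockSum-snoc 0 a)) ⟩
    blockSum 0 (suc a) + s + g ≡⟨ cong₂ (λ u v → blockSum 0 u + blockSum (suc v) j + enum p v) (sym h∸[1+j]≡1+a) (sym k∸[1+j]≡1+K) ⟩
    chunk-max j                ∎
    where
    open ≡-Reasoning
    2+j≤h : suc (suc j) ≤ h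
    2+j≤h = ≤-trans (s≤s j<h∸1) (≤-reflexive h∸1+1≡h)
    a = h ∸ suc (suc j)
    K = k ∸ suc (suc j)
    h∸[1+j]≡1+a : h ∸ suc j ≡ suc a
    h∸[1+j]≡1+a = ∸-≡suc∸suc 2+j≤h
    k∸[1+j]≡1+K : k ∸ suc j ≡ suc K
    k∸[1+j]≡1+K = ∸-≡suc∸suc (≤-trans 2+j≤h h≤k)
    x = blockSum 0 a
    g = enum p (suc K)
    s = blockSum (suc (suc K)) j
    e = enum p a
    lemma : ∀ x g s e → x + (g + s) + e ≡ x + e + s + g
    lemma = solve-∀

  gap-free⇒Representable : ∀ m → L ≤ m → m ≤ U → ¬ Gap m → Representable m
  gap-free⇒Representable m L≤m m≤U no-gap
    with consecutive-intervals-cover chunk-min chunk-max (h ∸ 1) (λ j j<h∸1 → m≤n⇒m≤1+n (≤-reflexive (chunks-adjacent j j<h∸1)))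
           m (≤-trans (≤-reflexive chunk-min-first) L≤m) (≤-trans m≤U (≤-reflexive (sym chunk-max-last)))
  ... | j , j≤h∸1 , min≤m , m≤max =
    subst Representable base+r≡m
      (frame-attains (chunk-frame j<h) r a≤r r≤K (no-gap ∘ subst Gap base+r≡m))
    where
    j<h : j < h
    j<h = ≤-trans (s≤s j≤h∸1) (≤-reflexive h∸1+1≡h)
    a = h ∸ suc j
    K = k ∸ suc j
    base = blockSum 0 a + blockSum (suc K) j
    r = m ∸ base
    base≤m : base ≤ m
    base≤m = ≤-trans (m≤m+n base _) min≤m
    base+r≡m : base + r ≡ m
    base+r≡m = m+[n∸m]≡n base≤m
    a≤r : enum p a ≤ r
    a≤r = ≤-trans (≤-reflexive (sym (m+n∸m≡n base (enum p a)))) (∸-monoˡ-≤ base min≤m)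
    r≤K : r ≤ enum p K
    r≤K = ≤-trans (∸-monoˡ-≤ base m≤max) (≤-reflexive (m+n∸m≡n base (enum p K)))

  Admissible : ℕ → Set
  Admissible m = L ≤ m × m ≤ U × ¬ Gap m

  image-Admissible⇔Sumset : ∀ x → ℕ-image Admissible x ⇔ Sumset x
  image-Admissible⇔Sumset x = mk⇔ to from
    where
    to : ℕ-image Admissible x → Sumset x
    to (m , refl , L≤m , m≤U , no-gap) = Representable⇒Sumset (gap-free⇒Representable m L≤m m≤U no-gap)
    from : Sumset x → ℕ-image Admissible x
    from x∈ with Sumset⇒selection x∈
    ... | C , sel , x≡σC = σ C , x≡σC , proj₁ (selection-bounds sel) , proj₂ (selection-bounds sel) , not-gap
      where
      not-gap : ¬ Gap (σ C)
      not-gap (gap-above-min p≡h σC≡1+L)   = σ≢1+L sel p≡h σC≡1+L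
      not-gap (gap-below-max p≡D 1+σC≡U)   = σ+1≢U sel p≡D 1+σC≡U
      not-gap (gap-h≡3 h≡3 p≡4 σC≡2+L)     = σ≢2+L sel h≡3 p≡4 σC≡2+L

  T : ℕ
  T = sum (iterate suc 0 h)

  L≡ : L ≡ T + (h ∸ 2) + (h ∸ p)
  L≡ = trans (blockSum-closed 0 h) (cong (λ z → z + T + (h ∸ 2) + (h ∸ p)) (*-zeroʳ h))

  U≡ : U ≡ h * D + T + h + (h ∸ (p ∸ D))
  U≡ = trans (blockSum-closed D h) (cong (λ z → h * D + T + (h ∸ z) + (h ∸ (p ∸ D))) (m≤n⇒m∸n≡0 (≤-trans (s≤s (s≤s z≤n)) 9≤D)))

  2+L≤U : 2 + L ≤ U
  2+L≤U = begin
    2 + L                                ≡⟨ cong (2 +_) L≡ ⟩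
    2 + (T + (h ∸ 2) + (h ∸ p))          ≤⟨ +-monoʳ-≤ 2 (+-monoʳ-≤ (T + (h ∸ 2)) (m∸n≤m h p)) ⟩
    2 + (T + (h ∸ 2) + h)                ≡⟨ lemma T (h ∸ 2) h ⟩
    T + (2 + (h ∸ 2)) + h                ≡⟨ cong (λ n → T + n + h) (m+[n∸m]≡n (≤-trans (s≤s (s≤s z≤n)) 3≤h)) ⟩
    T + h + h                            ≡⟨ cong (_+ h) (+-comm T h) ⟩
    h + T + h                            ≤⟨ +-monoˡ-≤ h (+-monoˡ-≤ T (m≤m*n h D {{>-nonZero (≤-trans (s≤s z≤n) 9≤D)}})) ⟩
    h * D + T + h                        ≤⟨ m≤m+n _ _ ⟩
    h * D + T + h + (h ∸ (p ∸ D))        ≡⟨ sym U≡ ⟩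
    U                                    ∎
    where
    open ≤-Reasoning
    lemma : ∀ t x h → 2 + (t + x + h) ≡ t + (2 + x) + h
    lemma = solve-∀

  widthWith : ℤ → ℤ → ℤ
  widthWith x y = ℤ.+ h *ℤ (ℤ.+ k -ℤ ℤ.+ h) +ℤ ℤ.+ 2 +ℤ x -ℤ y

  width : ℤ
  width = widthWith (ℤ.+ (h ∸ (p ∸ D))) (ℤ.+ (h ∸ p))

  U-L≡width : ℤ.+ U -ℤ ℤ.+ L ≡ width
  U-L≡width = begin
    ℤ.+ U -ℤ ℤ.+ L                                                  ≡⟨ cong₂ _-ℤ_ (cong ℤ.+_ U≡) (cong ℤ.+_ L≡) ⟩
    ℤ.+ (h * D) +ℤ ℤ.+ T +ℤ ℤ.+ h +ℤ x -ℤ (ℤ.+ T +ℤ ℤ.+ (h ∸ 2) +ℤ y)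
      ≡⟨ cong₂ (λ u v → u +ℤ ℤ.+ T +ℤ ℤ.+ h +ℤ x -ℤ (ℤ.+ T +ℤ v +ℤ y))
               (trans (ℤₚ.pos-* h D) (cong (ℤ.+ h *ℤ_) (+[m∸n]≡+m-+n h≤k))) (+[m∸n]≡+m-+n (≤-trans (s≤s (s≤s z≤n)) 3≤h)) ⟩
    ℤ.+ h *ℤ (ℤ.+ k -ℤ ℤ.+ h) +ℤ ℤ.+ T +ℤ ℤ.+ h +ℤ x -ℤ (ℤ.+ T +ℤ (ℤ.+ h -ℤ ℤ.+ 2) +ℤ y)
      ≡⟨ lemma (ℤ.+ h) (ℤ.+ k) (ℤ.+ T) x y ⟩
    width                                                            ∎
    where
    open ≡-Reasoning
    x = ℤ.+ (h ∸ (p ∸ D))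
    y = ℤ.+ (h ∸ p)
    lemma : ∀ h k t x y → h *ℤ (k -ℤ h) +ℤ t +ℤ h +ℤ x -ℤ (t +ℤ (h -ℤ ℤ.+ 2) +ℤ y)
                          ≡ h *ℤ (k -ℤ h) +ℤ ℤ.+ 2 +ℤ x -ℤ y
    lemma = ℤ-Solver.solve-∀

  CardIs-gap-free : (∀ m → ¬ Gap m) → CardIs Sumset (width +ℤ ℤ.+ 1)
  CardIs-gap-free no-gap =
    suc U ∸ L ,
    HasCard-⇔ image-Admissible⇔Sumset (HasCard-interval L U (m≤n⇒m≤1+n L≤U) (λ m → mk⇔ (λ (L≤m , m≤U , _) → L≤m , m≤U)
                                                                                     (λ (L≤m , m≤U) → L≤m , m≤U , no-gap m))) ,
    trans (+[m∸n]≡+m-+n (m≤n⇒m≤1+n L≤U)) (trans (lemma (ℤ.+ U) (ℤ.+ L)) (cong (_+ℤ ℤ.+ 1) U-L≡width))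
    where
    L≤U = ≤-trans (m≤n+m L 2) 2+L≤U
    lemma : ∀ u l → ℤ.+ 1 +ℤ u -ℤ l ≡ u -ℤ l +ℤ ℤ.+ 1
    lemma = ℤ-Solver.solve-∀

  CardIs-one-gap : ∀ e → Gap e → (∀ m → Gap m → m ≡ e) → L ≤ e → e ≤ U → CardIs Sumset width
  CardIs-one-gap e gap-e only-e L≤e e≤U =
    U ∸ L ,
    HasCard-⇔ image-Admissible⇔Sumset (HasCard-punctured-interval L e U L≤e e≤U (λ m →
      mk⇔ (λ (L≤m , m≤U , no-gap) → L≤m , m≤U , λ m≡e → no-gap (subst Gap (sym m≡e) gap-e))
          (λ (L≤m , m≤U , m≢e) → L≤m , m≤U , m≢e ∘ only-e m))) ,
    trans (+[m∸n]≡+m-+n (≤-trans L≤e e≤U)) U-L≡width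

  no-gaps : p ≢ h → p ≢ D → (h ≡ 3 → p ≢ 4) → ∀ m → ¬ Gap m
  no-gaps p≢h _   _   _ (gap-above-min p≡h _)   = p≢h p≡h
  no-gaps _   p≢D _   _ (gap-below-max p≡D _)   = p≢D p≡D
  no-gaps _   _   ¬h3 _ (gap-h≡3 h≡3 p≡4 _)     = ¬h3 h≡3 p≡4

  k∸[h∸c]≡c+D : ∀ c → c ≤ h → k ∸ (h ∸ c) ≡ c + D
  k∸[h∸c]≡c+D c c≤h = begin
    k ∸ (h ∸ c)       ≡⟨ cong (_∸ (h ∸ c)) (sym D+h≡k) ⟩
    D + h ∸ (h ∸ c)   ≡⟨ +-∸-assoc D (m∸n≤m h c) ⟩
    D + (h ∸ (h ∸ c)) ≡⟨ cong (D +_) (m∸[m∸n]≡n c≤h) ⟩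
    D + c             ≡⟨ +-comm D c ⟩
    c + D             ∎
    where open ≡-Reasoning

  width-at : ∀ {x y} → ℤ.+ (h ∸ (p ∸ D)) ≡ x → ℤ.+ (h ∸ p) ≡ y → width ≡ widthWith x y
  width-at = cong₂ widthWith

  h∸p≡0 : h ≤ p → ℤ.+ (h ∸ p) ≡ ℤ.+ 0
  h∸p≡0 h≤p = cong ℤ.+_ (m≤n⇒m∸n≡0 h≤p)

  h∸[p∸D]≡h : p ≤ D → ℤ.+ (h ∸ (p ∸ D)) ≡ ℤ.+ h
  h∸[p∸D]≡h p≤D = cong (λ n → ℤ.+ (h ∸ n)) (m≤n⇒m∸n≡0 p≤D)

  4≢3 : 4 ≢ 3
  4≢3 ()

  9≰4 : ¬ 9 ≤ 4
  9≰4 (s≤s (s≤s (s≤s (s≤s ()))))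

  card-y≥k-h+2 : k ∸ (h ∸ 2) ≤ suc p →
    CardIs Sumset (ℤ.+ h *ℤ ℤ.+ k -ℤ ℤ.+ h *ℤ ℤ.+ h +ℤ ℤ.+ k -ℤ ℤ.+ suc p +ℤ ℤ.+ 4)
  card-y≥k-h+2 y≥k-h+2 =
    CardIs-cong (CardIs-gap-free (no-gaps (>⇒≢ h<p) (>⇒≢ D<p) ¬h3))
                (trans (cong (_+ℤ ℤ.+ 1) (width-at x≡ (h∸p≡0 (<⇒≤ h<p)))) (lemma (ℤ.+ h) (ℤ.+ k) (ℤ.+ p)))
    where
    D<p : D < p
    D<p = ≤-pred (≤-trans (≤-reflexive (sym (k∸[h∸c]≡c+D 2 (≤-trans (s≤s (s≤s z≤n)) 3≤h)))) y≥k-h+2)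
    h<p = <-trans h<D D<p
    ¬h3 : h ≡ 3 → p ≢ 4
    ¬h3 _ p≡4 = 9≰4 (≤-trans 9≤D (≤-trans (<⇒≤ D<p) (≤-reflexive p≡4)))
    p∸D≤h : p ∸ D ≤ h
    p∸D≤h = ≤-trans (∸-monoˡ-≤ D (≤-trans (<⇒≤ p<k) (≤-reflexive (sym D+h≡k)))) (≤-reflexive (m+n∸m≡n D h))
    x≡ : ℤ.+ (h ∸ (p ∸ D)) ≡ ℤ.+ h -ℤ (ℤ.+ p -ℤ (ℤ.+ k -ℤ ℤ.+ h))
    x≡ = trans (+[m∸n]≡+m-+n p∸D≤h) (cong (ℤ.+ h -ℤ_) (trans (+[m∸n]≡+m-+n (<⇒≤ D<p)) (cong (ℤ.+ p -ℤ_) (+[m∸n]≡+m-+n h≤k))))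
    lemma : ∀ h k p → h *ℤ (k -ℤ h) +ℤ ℤ.+ 2 +ℤ (h -ℤ (p -ℤ (k -ℤ h))) -ℤ ℤ.+ 0 +ℤ ℤ.+ 1
                      ≡ h *ℤ k -ℤ h *ℤ h +ℤ k -ℤ (ℤ.+ 1 +ℤ p) +ℤ ℤ.+ 4
    lemma = ℤ-Solver.solve-∀

  card-y≡h+1 : suc p ≡ h + 1 → CardIs Sumset (ℤ.+ h *ℤ ℤ.+ k -ℤ ℤ.+ h *ℤ ℤ.+ h +ℤ ℤ.+ h +ℤ ℤ.+ 2)
  card-y≡h+1 y≡h+1 =
    CardIs-cong (CardIs-one-gap (suc L) (gap-above-min p≡h refl) only-gap (n≤1+n L) (≤-trans (n≤1+n _) 2+L≤U))
                (trans (width-at (h∸[p∸D]≡h (≤-trans (≤-reflexive p≡h) (<⇒≤ h<D))) (h∸p≡0 (≤-reflexive (sym p≡h))))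
                       (lemma (ℤ.+ h) (ℤ.+ k)))
    where
    p≡h : p ≡ h
    p≡h = suc-injective (trans y≡h+1 (+-comm h 1))
    only-gap : ∀ m → Gap m → m ≡ suc L
    only-gap m (gap-above-min _ m≡1+L) = m≡1+L
    only-gap m (gap-below-max p≡D _)   = contradiction (trans (sym p≡h) p≡D) (<⇒≢ h<D)
    only-gap m (gap-h≡3 h≡3 p≡4 _)     = contradiction (trans (sym p≡4) (trans p≡h h≡3)) 4≢3
    lemma : ∀ h k → h *ℤ (k -ℤ h) +ℤ ℤ.+ 2 +ℤ h -ℤ ℤ.+ 0 ≡ h *ℤ k -ℤ h *ℤ h +ℤ h +ℤ ℤ.+ 2
    lemma = ℤ-Solver.solve-∀

  card-y≡k-h+1 : suc p ≡ k ∸ (h ∸ 1) → CardIs Sumset (ℤ.+ h *ℤ ℤ.+ k -ℤ ℤ.+ h *ℤ ℤ.+ h +ℤ ℤ.+ h +ℤ ℤ.+ 2)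
  card-y≡k-h+1 y≡k-h+1 =
    CardIs-cong (CardIs-one-gap (pred U) (gap-below-max p≡D 1+[U-1]≡U) only-gap L≤U-1 pred[n]≤n)
                (trans (width-at (h∸[p∸D]≡h (≤-reflexive p≡D)) (h∸p≡0 (≤-trans (<⇒≤ h<D) (≤-reflexive (sym p≡D)))))
                       (lemma (ℤ.+ h) (ℤ.+ k)))
    where
    p≡D : p ≡ D
    p≡D = suc-injective (trans y≡k-h+1 (k∸[h∸c]≡c+D 1 (≤-trans (s≤s z≤n) 3≤h)))
    1+[U-1]≡U : suc (pred U) ≡ U
    1+[U-1]≡U = suc-pred U {{>-nonZero (≤-trans (s≤s z≤n) 2+L≤U)}}
    L≤U-1 : L ≤ pred U
    L≤U-1 = ≤-pred (≤-trans (m≤n+m (suc L) 1) (≤-trans 2+L≤U (≤-reflexive (sym 1+[U-1]≡U))))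
    only-gap : ∀ m → Gap m → m ≡ pred U
    only-gap m (gap-above-min p≡h _)   = contradiction (trans (sym p≡h) p≡D) (<⇒≢ h<D)
    only-gap m (gap-below-max _ 1+m≡U) = cong pred 1+m≡U
    only-gap m (gap-h≡3 _ p≡4 _)       = contradiction (≤-trans 9≤D (≤-reflexive (trans (sym p≡D) p≡4))) 9≰4
    lemma : ∀ h k → h *ℤ (k -ℤ h) +ℤ ℤ.+ 2 +ℤ h -ℤ ℤ.+ 0 ≡ h *ℤ k -ℤ h *ℤ h +ℤ h +ℤ ℤ.+ 2
    lemma = ℤ-Solver.solve-∀

  card-mid-gap-free : h < p → p < D → (h ≡ 3 → p ≢ 4) → CardIs Sumset (ℤ.+ h *ℤ ℤ.+ k -ℤ ℤ.+ h *ℤ ℤ.+ h +ℤ ℤ.+ h +ℤ ℤ.+ 3)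
  card-mid-gap-free h<p p<D ¬h3 =
    CardIs-cong (CardIs-gap-free (no-gaps (>⇒≢ h<p) (<⇒≢ p<D) ¬h3))
                (trans (cong (_+ℤ ℤ.+ 1) (width-at (h∸[p∸D]≡h (<⇒≤ p<D)) (h∸p≡0 (<⇒≤ h<p)))) (lemma (ℤ.+ h) (ℤ.+ k)))
    where
    lemma : ∀ h k → h *ℤ (k -ℤ h) +ℤ ℤ.+ 2 +ℤ h -ℤ ℤ.+ 0 +ℤ ℤ.+ 1 ≡ h *ℤ k -ℤ h *ℤ h +ℤ h +ℤ ℤ.+ 3
    lemma = ℤ-Solver.solve-∀

  card-h+3≤y≤k-h : h + 3 ≤ suc p → suc p ≤ k ∸ h → CardIs Sumset (ℤ.+ h *ℤ ℤ.+ k -ℤ ℤ.+ h *ℤ ℤ.+ h +ℤ ℤ.+ h +ℤ ℤ.+ 3)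
  card-h+3≤y≤k-h h+3≤y y≤D = card-mid-gap-free h<p y≤D ¬h3
    where
    h+2≤p : h + 2 ≤ p
    h+2≤p = ≤-pred (≤-trans (≤-reflexive (sym (+-suc h 2))) h+3≤y)
    h<p : h < p
    h<p = ≤-trans (≤-trans (m≤m+n (suc h) 1) (≤-reflexive (sym (+-suc h 1)))) h+2≤p
    ¬h3 : h ≡ 3 → p ≢ 4
    ¬h3 h≡3 p≡4 = contradiction (subst (λ n → n + 2 ≤ 4) h≡3 (subst (h + 2 ≤_) p≡4 h+2≤p)) (λ { (s≤s (s≤s (s≤s (s≤s ())))) })

  card-y≡h+2-h≥4 : suc p ≡ h + 2 → 4 ≤ h → CardIs Sumset (ℤ.+ h *ℤ ℤ.+ k -ℤ ℤ.+ h *ℤ ℤ.+ h +ℤ ℤ.+ h +ℤ ℤ.+ 3)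
  card-y≡h+2-h≥4 y≡h+2 4≤h = card-mid-gap-free h<p p<D (λ h≡3 _ → contradiction (≤-trans 4≤h (≤-reflexive h≡3)) 4≰3)
    where
    p≡h+1 : p ≡ h + 1
    p≡h+1 = suc-injective (trans y≡h+2 (+-suc h 1))
    h<p : h < p
    h<p = ≤-trans (≤-trans (m≤m+n (suc h) 0) (≤-reflexive (sym (+-suc h 0)))) (≤-reflexive (sym p≡h+1))
    p<D : p < D
    p<D = begin-strict
      p                ≡⟨ p≡h+1 ⟩
      h + 1            <⟨ +-monoʳ-< h (s≤s (s≤s z≤n)) ⟩
      h + 2            ≤⟨ m≤m+n (h + 2) (h + 1) ⟩
      h + 2 + (h + 1)  ≡⟨ lemma h ⟩
      2 * h + 3        ≤⟨ 2h+3≤D ⟩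
      D                ∎
      where
      open ≤-Reasoning
      lemma : ∀ h → h + 2 + (h + 1) ≡ 2 * h + 3
      lemma = solve-∀
    4≰3 : ¬ 4 ≤ 3
    4≰3 (s≤s (s≤s (s≤s ())))

  card-y≡h+2-h≡3 : suc p ≡ h + 2 → h ≡ 3 → CardIs Sumset (ℤ.+ 3 *ℤ ℤ.+ k -ℤ ℤ.+ 4)
  card-y≡h+2-h≡3 y≡h+2 h≡3 =
    CardIs-cong (CardIs-one-gap (2 + L) (gap-h≡3 h≡3 p≡4 refl) only-gap (m≤n+m L 2) 2+L≤U)
                (trans (width-at (h∸[p∸D]≡h p≤D) (h∸p≡0 h≤p))
                       (trans (cong (λ n → ℤ.+ n *ℤ (ℤ.+ k -ℤ ℤ.+ n) +ℤ ℤ.+ 2 +ℤ ℤ.+ n -ℤ ℤ.+ 0) h≡3) (lemma (ℤ.+ k))))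
    where
    p≡4 : p ≡ 4
    p≡4 = suc-injective (trans y≡h+2 (cong (_+ 2) h≡3))
    h≤p : h ≤ p
    h≤p = ≤-trans (≤-reflexive h≡3) (≤-trans (n≤1+n 3) (≤-reflexive (sym p≡4)))
    p≤D : p ≤ D
    p≤D = ≤-trans (≤-reflexive p≡4) (≤-trans (s≤s (s≤s (s≤s (s≤s z≤n)))) 9≤D)
    only-gap : ∀ m → Gap m → m ≡ 2 + L
    only-gap m (gap-above-min p≡h _)     = contradiction (trans (sym p≡4) (trans p≡h h≡3)) 4≢3
    only-gap m (gap-below-max p≡D _)     = contradiction (≤-trans 9≤D (≤-reflexive (trans (sym p≡D) p≡4))) 9≰4
    only-gap m (gap-h≡3 _ _ m≡2+L)       = m≡2+L
    lemma : ∀ k → ℤ.+ 3 *ℤ (k -ℤ ℤ.+ 3) +ℤ ℤ.+ 2 +ℤ ℤ.+ 3 -ℤ ℤ.+ 0 ≡ ℤ.+ 3 *ℤ k -ℤ ℤ.+ 4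
    lemma = ℤ-Solver.solve-∀

  card-y≤h : suc p ≤ h → CardIs Sumset (ℤ.+ h *ℤ ℤ.+ k -ℤ ℤ.+ h *ℤ ℤ.+ h +ℤ ℤ.+ suc p +ℤ ℤ.+ 2)
  card-y≤h p<h =
    CardIs-cong (CardIs-gap-free (no-gaps (<⇒≢ p<h) (<⇒≢ p<D) ¬h3))
                (trans (cong (_+ℤ ℤ.+ 1) (width-at (h∸[p∸D]≡h (<⇒≤ p<D)) (+[m∸n]≡+m-+n (<⇒≤ p<h)))) (lemma (ℤ.+ h) (ℤ.+ k) (ℤ.+ p)))
    where
    p<D : p < D
    p<D = <-trans p<h h<D
    ¬h3 : h ≡ 3 → p ≢ 4
    ¬h3 h≡3 p≡4 = <⇒≱ p<h (≤-trans (≤-reflexive h≡3) (≤-trans (n≤1+n 3) (≤-reflexive (sym p≡4))))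
    lemma : ∀ h k p → h *ℤ (k -ℤ h) +ℤ ℤ.+ 2 +ℤ h -ℤ (h -ℤ p) +ℤ ℤ.+ 1 ≡ h *ℤ k -ℤ h *ℤ h +ℤ (ℤ.+ 1 +ℤ p) +ℤ ℤ.+ 2
    lemma = ℤ-Solver.solve-∀

open import Data.Integer using (+_)

proposition2p7 : (h k y : ℕ) → 3 ≤ h → 3 * h + 3 ≤ k → 5 ≤ y → y ≤ k →
    ((k ∸ (h ∸ 2) ≤ y → CardIs (RestrictedSumset h (SetA k y))
        ((+ h *ℤ + k) -ℤ (+ h *ℤ + h) +ℤ + k -ℤ + y +ℤ + 4))
    × ((y ≡ h + 1 ⊎ y ≡ k ∸ (h ∸ 1)) → CardIs (RestrictedSumset h (SetA k y))
        ((+ h *ℤ + k) -ℤ (+ h *ℤ + h) +ℤ + h +ℤ + 2))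
    × (h + 3 ≤ y → y ≤ k ∸ h → CardIs (RestrictedSumset h (SetA k y))
        ((+ h *ℤ + k) -ℤ (+ h *ℤ + h) +ℤ + h +ℤ + 3))
    × (y ≡ h + 2 → 4 ≤ h → CardIs (RestrictedSumset h (SetA k y))
        ((+ h *ℤ + k) -ℤ (+ h *ℤ + h) +ℤ + h +ℤ + 3))
    × (y ≡ h + 2 → h ≡ 3 → CardIs (RestrictedSumset h (SetA k y))
        ((+ 3 *ℤ + k) -ℤ + 4))
    × (y ≤ h → CardIs (RestrictedSumset h (SetA k y))
        ((+ h *ℤ + k) -ℤ (+ h *ℤ + h) +ℤ + y +ℤ + 2)))
proposition2p7 h k (suc p) 3≤h 3h+3≤k (s≤s 4≤p) y≤k =
  card-y≥k-h+2 ,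
  (λ { (inj₁ y≡h+1) → card-y≡h+1 y≡h+1 ; (inj₂ y≡k-h+1) → card-y≡k-h+1 y≡k-h+1 }) ,
  card-h+3≤y≤k-h ,
  card-y≡h+2-h≥4 ,
  card-y≡h+2-h≡3 ,
  card-y≤h
  where open SumsetA h k p 3≤h 3h+3≤k 4≤p y≤k
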